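{- Suppose that for all distributed MALL formulas $A_d,B_d$, $A_d\cong B_d$ implies $A_d=_{\mathcal{AC}}B_d$. Then for all MALL formulas $A,B$, $A\cong B$ implies $A=_{\mathcal{E}}B$.
   Context: MALL formulas: $A::=X\mid X^\perp\mid A\otimes A\mid A⅋A\mid1\mid\bot\mid A\&A\mid A\oplus A\mid\top\mid0$ with De Morgan negation ($(A\otimes B)^\perp=B^\perp⅋A^\perp$, $(A\&B)^\perp=B^\perp\oplus A^\perp$, $1^\perp=\bot$, $\top^\perp=0$, involutive). $A\cong B$ means there are MALL sequent calculus proofs $\pi$ of $\vdash A^\perp,B$ and $\pi'$ of $\vdash B^\perp,A$ whose cut on $B$ equals the axiom proof of $\vdash A^\perp,A$ and whose cut on $A$ equals the axiom proof of $\vdash B^\perp,B$, up to the equivalence generated by cut-elimination steps and axiom-expansion. $\mathcal{E}$ is the congruence generated by associativity and commutativity of $\otimes,⅋,\oplus,\&$; $A\otimes(B\oplus C)=(A\otimes B)\oplus(A\otimes C)$; $A⅋(B\&C)=(A⅋B)\&(A⅋C)$; $A\otimes1=A$; $A⅋\bot=A$; $A\oplus0=A$; $A\&\top=A$; $A\otimes0=0$; $A⅋\top=\top$. $\mathcal{AC}$ is the subtheory with associativity and commutativity only. A formula is distributed if it has no subformula of the forms $A\otimes(B\oplus C)$, $(A\oplus B)\otimes C$, $A\otimes1$, $1\otimes A$, $A\oplus0$, $0\oplus A$, $A\otimes0$, $0\otimes A$, $(C\&B)⅋A$, $C⅋(B\&A)$, $\bot⅋A$, $A⅋\bot$, $\top\&A$,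 $A\&\top$, $\top⅋A$, $A⅋\top$. -}

module Defs where

open import Data.Nat using (ℕ)
open import Data.Fin using (Fin; zero; suc)
open import Data.List using (List; []; _∷_; _++_; length)
open import Data.List.Properties using (++-assoc; ++-identityʳ)
open import Data.Empty using (⊥)
open import Data.Product using (Σ; _×_)
open import Relation.Nullary using (¬_)
open import Relation.Binary.PropositionalEquality
  using (_≡_; refl; sym; trans; cong; cong₂; subst)
open import Data.List.Relation.Binary.Permutation.Propositional as P
  using (_↭_; ↭-reflexive)
open import Data.List.Relation.Binary.Permutation.Propositional.Properties
  using (shift; ++-comm; ++⁺ˡ; ++⁺ʳ; ∷↭∷ʳ)

infixr 7 _⊗_ _⅋_
infixr 6 _⊕_ _&_

data Formula : Set where
  var   : ℕ → Formula
  covar : ℕ → Formula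
  _⊗_   : Formula → Formula → Formula
  _⅋_   : Formula → Formula → Formula
  one   : Formula
  bot   : Formula
  _&_   : Formula → Formula → Formula
  _⊕_   : Formula → Formula → Formula
  top   : Formula
  nul   : Formula

neg : Formula → Formula
neg (var n)   = covar n
neg (covar n) = var n
neg (A ⊗ B)   = neg B ⅋ neg A
neg (A ⅋ B)   = neg B ⊗ neg A
neg one       = bot
neg bot       = one
neg (A & B)   = neg B ⊕ neg A
neg (A ⊕ B)   = neg B & neg A
neg top       = nul
neg nul       = top

neg-invol : ∀ A → neg (neg A) ≡ A
neg-invol (var n)   = refl
neg-invol (covar n) = refl
neg-invol (A ⊗ B)   = cong₂ _⊗_ (neg-invol A) (neg-invol B)
neg-invol (A ⅋ B)   = cong₂ _⅋_ (neg-invol A) (neg-invol B)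
neg-invol one       = refl
neg-invol bot       = refl
neg-invol (A & B)   = cong₂ _&_ (neg-invol A) (neg-invol B)
neg-invol (A ⊕ B)   = cong₂ _⊕_ (neg-invol A) (neg-invol B)
neg-invol top       = refl
neg-invol nul       = refl

-- Sequents are lists; the principal
-- formula of every logical rule (and the cut formula) is the head of
-- its premise(s)/conclusion, and an explicit exchange rule permutes
-- sequents (a permutation is a proof-relevant witness of _↭_).

infix 2 ⊢_

data ⊢_ : List Formula → Set where
  ax      : ∀ A → ⊢ neg A ∷ A ∷ []
  ex      : ∀ {Γ Δ} → Γ ↭ Δ → ⊢ Γ → ⊢ Δ
  cut     : ∀ {Γ Δ} A → ⊢ A ∷ Γ → ⊢ neg A ∷ Δ → ⊢ Γ ++ Δ
  one-r   : ⊢ one ∷ []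
  bot-r   : ∀ {Γ} → ⊢ Γ → ⊢ bot ∷ Γ
  tens-r  : ∀ {A B Γ Δ} → ⊢ A ∷ Γ → ⊢ B ∷ Δ → ⊢ A ⊗ B ∷ Γ ++ Δ
  par-r   : ∀ {A B Γ} → ⊢ A ∷ B ∷ Γ → ⊢ A ⅋ B ∷ Γ
  top-r   : ∀ {Γ} → ⊢ top ∷ Γ
  with-r  : ∀ {A B Γ} → ⊢ A ∷ Γ → ⊢ B ∷ Γ → ⊢ A & B ∷ Γ
  plus1-r : ∀ {A B Γ} → ⊢ A ∷ Γ → ⊢ A ⊕ B ∷ Γ
  plus2-r : ∀ {A B Γ} → ⊢ B ∷ Γ → ⊢ A ⊕ B ∷ Γ

act : ∀ {Γ Δ : List Formula} → Γ ↭ Δ → Fin (length Γ) → Fin (length Δ)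
act P.refl i = i
act (P.prep x p) zero = zero
act (P.prep x p) (suc i) = suc (act p i)
act (P.swap x y p) zero = suc zero
act (P.swap x y p) (suc zero) = zero
act (P.swap x y p) (suc (suc i)) = suc (suc (act p i))
act (P.trans p q) i = act q (act p i)

cast : ∀ {Γ Δ} → Γ ≡ Δ → ⊢ Γ → ⊢ Δ
cast e π = ex (↭-reflexive e) π

transport : ∀ {A B Γ} → A ≡ B → ⊢ A ∷ Γ → ⊢ B ∷ Γ
transport {Γ = Γ} e π = subst (λ X → ⊢ X ∷ Γ) e π

sw : ∀ {A B : Formula} → A ∷ B ∷ [] ↭ B ∷ A ∷ []
sw {A} {B} = P.swap A B P.refl

rev3 : ∀ {A B C : Formula} → A ∷ B ∷ C ∷ [] ↭ C ∷ B ∷ A ∷ []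
rev3 {A} {B} {C} = P.trans (P.swap A B P.refl)
                     (P.trans (P.prep B (P.swap A C P.refl)) (P.swap B C P.refl))

gcut : ∀ Σ₁ {C Σ₂ Δ} → ⊢ Σ₁ ++ C ∷ Σ₂ → ⊢ neg C ∷ Δ → ⊢ Σ₁ ++ Δ ++ Σ₂
gcut Σ₁ {C} {Σ₂} {Δ} π π' =
  ex (P.trans (↭-reflexive (++-assoc Σ₁ Σ₂ Δ)) (++⁺ˡ Σ₁ (++-comm Σ₂ Δ)))
     (cut C (ex (shift C Σ₁ Σ₂) π) π')

assoc3 : ∀ (Σ₁ Δ Σ₂ Θ : List Formula) →
         (Σ₁ ++ Δ ++ Σ₂) ++ Θ ≡ Σ₁ ++ Δ ++ Σ₂ ++ Θ
assoc3 Σ₁ Δ Σ₂ Θ = trans (++-assoc Σ₁ (Δ ++ Σ₂) Θ) (cong (Σ₁ ++_) (++-assoc Δ Σ₂ Θ))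

-- Equality of proofs: the congruence (equivalence closed under all
-- rules) generated by cut-elimination steps and axiom expansion, on
-- top of the exchange bureaucracy (sequents are really multisets).

infix 1 _≈_

data _≈_ : ∀ {Γ} → ⊢ Γ → ⊢ Γ → Set where
  ≈-refl  : ∀ {Γ} {π : ⊢ Γ} → π ≈ π
  ≈-sym   : ∀ {Γ} {π ρ : ⊢ Γ} → π ≈ ρ → ρ ≈ π
  ≈-trans : ∀ {Γ} {π ρ σ : ⊢ Γ} → π ≈ ρ → ρ ≈ σ → π ≈ σ
  ex-cong    : ∀ {Γ Δ} (p : Γ ↭ Δ) {π ρ : ⊢ Γ} → π ≈ ρ → ex p π ≈ ex p ρ
  cut-cong   : ∀ {Γ Δ} A {π ρ : ⊢ A ∷ Γ} {π' ρ' : ⊢ neg A ∷ Δ} →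
               π ≈ ρ → π' ≈ ρ' → cut A π π' ≈ cut A ρ ρ'
  bot-cong   : ∀ {Γ} {π ρ : ⊢ Γ} → π ≈ ρ → bot-r π ≈ bot-r ρ
  tens-cong  : ∀ {A B Γ Δ} {π ρ : ⊢ A ∷ Γ} {π' ρ' : ⊢ B ∷ Δ} →
               π ≈ ρ → π' ≈ ρ' → tens-r π π' ≈ tens-r ρ ρ'
  par-cong   : ∀ {A B Γ} {π ρ : ⊢ A ∷ B ∷ Γ} → π ≈ ρ → par-r π ≈ par-r ρ
  with-cong  : ∀ {A B Γ} {π ρ : ⊢ A ∷ Γ} {π' ρ' : ⊢ B ∷ Γ} →
               π ≈ ρ → π' ≈ ρ' → with-r π π' ≈ with-r ρ ρ'
  plus1-cong : ∀ {A B Γ} {π ρ : ⊢ A ∷ Γ} → π ≈ ρ → plus1-r {A} {B} π ≈ plus1-r ρ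
  plus2-cong : ∀ {A B Γ} {π ρ : ⊢ B ∷ Γ} → π ≈ ρ → plus2-r {A} {B} π ≈ plus2-r ρ

  -- exchange bureaucracy: only the induced bijection on occurrences matters
  ex-act   : ∀ {Γ Δ} (p q : Γ ↭ Δ) (π : ⊢ Γ) →
             (∀ i → act p i ≡ act q i) → ex p π ≈ ex q π
  ex-id    : ∀ {Γ} (π : ⊢ Γ) → ex P.refl π ≈ π
  ex-ex    : ∀ {Γ Δ Θ} (q : Γ ↭ Δ) (p : Δ ↭ Θ) (π : ⊢ Γ) →
             ex p (ex q π) ≈ ex (P.trans q p) π
  exd-bot   : ∀ {Γ Δ} (p : Γ ↭ Δ) (π : ⊢ Γ) →
              bot-r (ex p π) ≈ ex (P.prep bot p) (bot-r π)
  exd-par   : ∀ {A B Γ Δ} (p : Γ ↭ Δ) (π : ⊢ A ∷ B ∷ Γ) →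
              par-r (ex (P.prep A (P.prep B p)) π) ≈ ex (P.prep (A ⅋ B) p) (par-r π)
  exd-tensl : ∀ {A B Γ Γ' Δ} (p : Γ ↭ Γ') (π : ⊢ A ∷ Γ) (π' : ⊢ B ∷ Δ) →
              tens-r (ex (P.prep A p) π) π' ≈ ex (P.prep (A ⊗ B) (++⁺ʳ Δ p)) (tens-r π π')
  exd-tensr : ∀ {A B Γ Δ Δ'} (p : Δ ↭ Δ') (π : ⊢ A ∷ Γ) (π' : ⊢ B ∷ Δ) →
              tens-r π (ex (P.prep B p) π') ≈ ex (P.prep (A ⊗ B) (++⁺ˡ Γ p)) (tens-r π π')
  exd-with  : ∀ {A B Γ Δ} (p : Γ ↭ Δ) (π : ⊢ A ∷ Γ) (π' : ⊢ B ∷ Γ) →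
              with-r (ex (P.prep A p) π) (ex (P.prep B p) π') ≈ ex (P.prep (A & B) p) (with-r π π')
  exd-plus1 : ∀ {A B Γ Δ} (p : Γ ↭ Δ) (π : ⊢ A ∷ Γ) →
              plus1-r {A} {B} (ex (P.prep A p) π) ≈ ex (P.prep (A ⊕ B) p) (plus1-r π)
  exd-plus2 : ∀ {A B Γ Δ} (p : Γ ↭ Δ) (π : ⊢ B ∷ Γ) →
              plus2-r {A} {B} (ex (P.prep B p) π) ≈ ex (P.prep (A ⊕ B) p) (plus2-r π)
  exd-top   : ∀ {Γ Δ} (p : Γ ↭ Δ) → top-r {Δ} ≈ ex (P.prep top p) (top-r {Γ})
  exd-cutl  : ∀ {A Γ Γ' Δ} (p : Γ ↭ Γ') (π : ⊢ A ∷ Γ) (π' : ⊢ neg A ∷ Δ) →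
              cut A (ex (P.prep A p) π) π' ≈ ex (++⁺ʳ Δ p) (cut A π π')
  exd-cutr  : ∀ {A Γ Δ Δ'} (p : Δ ↭ Δ') (π : ⊢ A ∷ Γ) (π' : ⊢ neg A ∷ Δ) →
              cut A π (ex (P.prep (neg A) p) π') ≈ ex (++⁺ˡ Γ p) (cut A π π')
  ax-sym    : ∀ A → ex sw (ax A) ≈ transport (neg-invol A) (ax (neg A))
  cut-sym   : ∀ {A Γ Δ} (π : ⊢ A ∷ Γ) (π' : ⊢ neg A ∷ Δ) →
              cut A π π' ≈ ex (++-comm Δ Γ) (cut (neg A) π' (transport (sym (neg-invol A)) π))

  cut-axl   : ∀ {A Δ} (π : ⊢ neg (neg A) ∷ Δ) →
              cut (neg A) (ax A) π ≈ transport (neg-invol A) π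
  cut-axr   : ∀ {A Γ} (π : ⊢ A ∷ Γ) → cut A π (ax A) ≈ ex (∷↭∷ʳ A Γ) π
  key-tens  : ∀ {A B Γ₁ Γ₂ Δ} (π₁ : ⊢ A ∷ Γ₁) (π₂ : ⊢ B ∷ Γ₂) (π₃ : ⊢ neg B ∷ neg A ∷ Δ) →
              cut (A ⊗ B) (tens-r π₁ π₂) (par-r π₃)
              ≈ cast (sym (++-assoc Γ₁ Γ₂ Δ))
                     (cut A π₁ (ex (shift (neg A) Γ₂ Δ) (cut B π₂ π₃)))
  key-par   : ∀ {A B Γ Δ₁ Δ₂} (π : ⊢ A ∷ B ∷ Γ) (π₁ : ⊢ neg B ∷ Δ₁) (π₂ : ⊢ neg A ∷ Δ₂) →
              cut (A ⅋ B) (par-r π) (tens-r π₁ π₂)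
              ≈ ex (P.trans (↭-reflexive (++-assoc Γ Δ₂ Δ₁)) (++⁺ˡ Γ (++-comm Δ₂ Δ₁)))
                   (cut B (cut A π π₂) π₁)
  key-one   : ∀ {Δ} (π : ⊢ Δ) → cut one one-r (bot-r π) ≈ π
  key-bot   : ∀ {Γ} (π : ⊢ Γ) → cut bot (bot-r π) one-r ≈ cast (sym (++-identityʳ Γ)) π
  key-with1 : ∀ {A B Γ Δ} (π₁ : ⊢ A ∷ Γ) (π₂ : ⊢ B ∷ Γ) (π : ⊢ neg B ∷ Δ) →
              cut (A & B) (with-r π₁ π₂) (plus1-r π) ≈ cut B π₂ π
  key-with2 : ∀ {A B Γ Δ} (π₁ : ⊢ A ∷ Γ) (π₂ : ⊢ B ∷ Γ) (π : ⊢ neg A ∷ Δ) →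
              cut (A & B) (with-r π₁ π₂) (plus2-r π) ≈ cut A π₁ π
  key-plus1 : ∀ {A B Γ Δ} (π : ⊢ A ∷ Γ) (π₁ : ⊢ neg B ∷ Δ) (π₂ : ⊢ neg A ∷ Δ) →
              cut (A ⊕ B) (plus1-r π) (with-r π₁ π₂) ≈ cut A π π₂
  key-plus2 : ∀ {A B Γ Δ} (π : ⊢ B ∷ Γ) (π₁ : ⊢ neg B ∷ Δ) (π₂ : ⊢ neg A ∷ Δ) →
              cut (A ⊕ B) (plus2-r π) (with-r π₁ π₂) ≈ cut B π π₁
  com-bot   : ∀ Σ₁ {C Σ₂ Δ} (π : ⊢ Σ₁ ++ C ∷ Σ₂) (π' : ⊢ neg C ∷ Δ) →
              gcut (bot ∷ Σ₁) (bot-r π) π' ≈ bot-r (gcut Σ₁ π π')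
  com-par   : ∀ Σ₁ {A B C Σ₂ Δ} (π : ⊢ A ∷ B ∷ Σ₁ ++ C ∷ Σ₂) (π' : ⊢ neg C ∷ Δ) →
              gcut (A ⅋ B ∷ Σ₁) (par-r π) π' ≈ par-r (gcut (A ∷ B ∷ Σ₁) π π')
  com-with  : ∀ Σ₁ {A B C Σ₂ Δ} (π₁ : ⊢ A ∷ Σ₁ ++ C ∷ Σ₂) (π₂ : ⊢ B ∷ Σ₁ ++ C ∷ Σ₂)
              (π' : ⊢ neg C ∷ Δ) →
              gcut (A & B ∷ Σ₁) (with-r π₁ π₂) π'
              ≈ with-r (gcut (A ∷ Σ₁) π₁ π') (gcut (B ∷ Σ₁) π₂ π')
  com-plus1 : ∀ Σ₁ {A B C Σ₂ Δ} (π : ⊢ A ∷ Σ₁ ++ C ∷ Σ₂) (π' : ⊢ neg C ∷ Δ) →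
              gcut (A ⊕ B ∷ Σ₁) (plus1-r π) π' ≈ plus1-r (gcut (A ∷ Σ₁) π π')
  com-plus2 : ∀ Σ₁ {A B C Σ₂ Δ} (π : ⊢ B ∷ Σ₁ ++ C ∷ Σ₂) (π' : ⊢ neg C ∷ Δ) →
              gcut (A ⊕ B ∷ Σ₁) (plus2-r π) π' ≈ plus2-r (gcut (B ∷ Σ₁) π π')
  com-top   : ∀ Σ₁ {C Σ₂ Δ} (π' : ⊢ neg C ∷ Δ) →
              gcut (top ∷ Σ₁) {C} {Σ₂} top-r π' ≈ top-r
  com-tensl : ∀ Σ₁ {A B C Σ₂ Θ Δ} (π₁ : ⊢ A ∷ Σ₁ ++ C ∷ Σ₂) (π₂ : ⊢ B ∷ Θ)
              (π' : ⊢ neg C ∷ Δ) →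
              gcut (A ⊗ B ∷ Σ₁) (cast (cong (A ⊗ B ∷_) (++-assoc Σ₁ (C ∷ Σ₂) Θ))
                                      (tens-r π₁ π₂)) π'
              ≈ cast (cong (A ⊗ B ∷_) (assoc3 Σ₁ Δ Σ₂ Θ))
                     (tens-r (gcut (A ∷ Σ₁) π₁ π') π₂)
  com-tensr : ∀ Σ₁ {A B C Σ₂ Θ Δ} (π₁ : ⊢ A ∷ Θ) (π₂ : ⊢ B ∷ Σ₁ ++ C ∷ Σ₂)
              (π' : ⊢ neg C ∷ Δ) →
              gcut (A ⊗ B ∷ Θ ++ Σ₁) (cast (cong (A ⊗ B ∷_) (sym (++-assoc Θ Σ₁ (C ∷ Σ₂))))
                                          (tens-r π₁ π₂)) π'
              ≈ cast (cong (A ⊗ B ∷_) (sym (++-assoc Θ Σ₁ (Δ ++ Σ₂))))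
                     (tens-r π₁ (gcut (B ∷ Σ₁) π₂ π'))
  com-cutl  : ∀ Σ₁ {D C Σ₂ Θ Δ} (ρ₁ : ⊢ D ∷ Σ₁ ++ C ∷ Σ₂) (ρ₂ : ⊢ neg D ∷ Θ)
              (π' : ⊢ neg C ∷ Δ) →
              gcut Σ₁ (cast (++-assoc Σ₁ (C ∷ Σ₂) Θ) (cut D ρ₁ ρ₂)) π'
              ≈ cast (assoc3 Σ₁ Δ Σ₂ Θ) (cut D (gcut (D ∷ Σ₁) ρ₁ π') ρ₂)
  com-cutr  : ∀ Σ₁ {D C Σ₂ Θ Δ} (ρ₁ : ⊢ D ∷ Θ) (ρ₂ : ⊢ neg D ∷ Σ₁ ++ C ∷ Σ₂)
              (π' : ⊢ neg C ∷ Δ) →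
              gcut (Θ ++ Σ₁) (cast (sym (++-assoc Θ Σ₁ (C ∷ Σ₂))) (cut D ρ₁ ρ₂)) π'
              ≈ cast (sym (++-assoc Θ Σ₁ (Δ ++ Σ₂))) (cut D ρ₁ (gcut (neg D ∷ Σ₁) ρ₂ π'))
  η-tens : ∀ A B → ax (A ⊗ B) ≈ par-r (ex rev3 (tens-r (ex sw (ax A)) (ex sw (ax B))))
  η-par  : ∀ A B → ax (A ⅋ B) ≈ ex sw (par-r (ex rev3 (tens-r (ax B) (ax A))))
  η-with : ∀ A B → ax (A & B) ≈ ex sw (with-r (ex sw (plus2-r (ax A))) (ex sw (plus1-r (ax B))))
  η-plus : ∀ A B → ax (A ⊕ B) ≈ with-r (ex sw (plus2-r (ex sw (ax B)))) (ex sw (plus1-r (ex sw (ax A))))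
  η-one  : ax one ≈ bot-r one-r
  η-bot  : ax bot ≈ ex sw (bot-r one-r)
  η-top  : ax top ≈ ex sw top-r
  η-nul  : ax nul ≈ top-r

infix 4 _≅_

_≅_ : Formula → Formula → Set
A ≅ B = Σ (⊢ neg A ∷ B ∷ []) λ π → Σ (⊢ neg B ∷ A ∷ []) λ π' →
          (cut B (ex sw π) π' ≈ ax A) × (cut A (ex sw π') π ≈ ax B)

data AxAC : Formula → Formula → Set where
  ⊗-assoc : ∀ A B C → AxAC ((A ⊗ B) ⊗ C) (A ⊗ (B ⊗ C))
  ⅋-assoc : ∀ A B C → AxAC ((A ⅋ B) ⅋ C) (A ⅋ (B ⅋ C))
  ⊕-assoc : ∀ A B C → AxAC ((A ⊕ B) ⊕ C) (A ⊕ (B ⊕ C))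
  &-assoc : ∀ A B C → AxAC ((A & B) & C) (A & (B & C))
  ⊗-comm  : ∀ A B → AxAC (A ⊗ B) (B ⊗ A)
  ⅋-comm  : ∀ A B → AxAC (A ⅋ B) (B ⅋ A)
  ⊕-comm  : ∀ A B → AxAC (A ⊕ B) (B ⊕ A)
  &-comm  : ∀ A B → AxAC (A & B) (B & A)

data AxE : Formula → Formula → Set where
  ac       : ∀ {A B} → AxAC A B → AxE A B
  ⊗-distr  : ∀ A B C → AxE (A ⊗ (B ⊕ C)) ((A ⊗ B) ⊕ (A ⊗ C))
  ⅋-distr  : ∀ A B C → AxE (A ⅋ (B & C)) ((A ⅋ B) & (A ⅋ C))
  ⊗-unit   : ∀ A → AxE (A ⊗ one) A
  ⅋-unit   : ∀ A → AxE (A ⅋ bot) A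
  ⊕-unit   : ∀ A → AxE (A ⊕ nul) A
  &-unit   : ∀ A → AxE (A & top) A
  ⊗-zero   : ∀ A → AxE (A ⊗ nul) nul
  ⅋-zero   : ∀ A → AxE (A ⅋ top) top

data Cong (Ax : Formula → Formula → Set) : Formula → Formula → Set where
  axiom  : ∀ {A B} → Ax A B → Cong Ax A B
  refl'  : ∀ {A} → Cong Ax A A
  sym'   : ∀ {A B} → Cong Ax A B → Cong Ax B A
  trans' : ∀ {A B C} → Cong Ax A B → Cong Ax B C → Cong Ax A C
  ⊗-cong : ∀ {A A' B B'} → Cong Ax A A' → Cong Ax B B' → Cong Ax (A ⊗ B) (A' ⊗ B')
  ⅋-cong : ∀ {A A' B B'} → Cong Ax A A' → Cong Ax B B' → Cong Ax (A ⅋ B) (A' ⅋ B')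
  &-cong : ∀ {A A' B B'} → Cong Ax A A' → Cong Ax B B' → Cong Ax (A & B) (A' & B')
  ⊕-cong : ∀ {A A' B B'} → Cong Ax A A' → Cong Ax B B' → Cong Ax (A ⊕ B) (A' ⊕ B')

infix 4 _=AC_ _=E_

_=AC_ : Formula → Formula → Set
_=AC_ = Cong AxAC

_=E_ : Formula → Formula → Set
_=E_ = Cong AxE

data Bad : Formula → Set where
  b1  : ∀ A B C → Bad (A ⊗ (B ⊕ C))
  b2  : ∀ A B C → Bad ((A ⊕ B) ⊗ C)
  b3  : ∀ A → Bad (A ⊗ one)
  b4  : ∀ A → Bad (one ⊗ A)
  b5  : ∀ A → Bad (A ⊕ nul)
  b6  : ∀ A → Bad (nul ⊕ A)
  b7  : ∀ A → Bad (A ⊗ nul)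
  b8  : ∀ A → Bad (nul ⊗ A)
  b9  : ∀ A B C → Bad ((C & B) ⅋ A)
  b10 : ∀ A B C → Bad (C ⅋ (B & A))
  b11 : ∀ A → Bad (bot ⅋ A)
  b12 : ∀ A → Bad (A ⅋ bot)
  b13 : ∀ A → Bad (top & A)
  b14 : ∀ A → Bad (A & top)
  b15 : ∀ A → Bad (top ⅋ A)
  b16 : ∀ A → Bad (A ⅋ top)

data Sub : Formula → Formula → Set where
  here : ∀ {A} → Sub A A
  ⊗l : ∀ {B A C} → Sub B A → Sub B (A ⊗ C)
  ⊗r : ∀ {B A C} → Sub B C → Sub B (A ⊗ C)
  ⅋l : ∀ {B A C} → Sub B A → Sub B (A ⅋ C)
  ⅋r : ∀ {B A C} → Sub B C → Sub B (A ⅋ C)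
  &l : ∀ {B A C} → Sub B A → Sub B (A & C)
  &r : ∀ {B A C} → Sub B C → Sub B (A & C)
  ⊕l : ∀ {B A C} → Sub B A → Sub B (A ⊕ C)
  ⊕r : ∀ {B A C} → Sub B C → Sub B (A ⊕ C)

Distributed : Formula → Set
Distributed A = ∀ B → Sub B A → ¬ Bad B

-- Every formula A is E-equal to a distributed normal form nf A, obtained by
-- orienting commutativity, the distributivity of ⊗ over ⊕ and of ⅋ over &, the
-- units and the zeros.  Each of these axioms is realised by a MALL isomorphism,
-- and ≅ is a congruence, so also A ≅ nf A.  (Only the ⊗/⊕ cases are built by hand
-- from cut-elimination and η-steps; the ⅋/& ones are their De Morgan duals, as
-- negation preserves ≅.)  Given A ≅ B we get nf A ≅ nf B, the hypothesis turns
-- this into nf A =AC nf B, and AC ⊆ E.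
module Submission where

open import Defs
open import Data.Fin using (Fin; zero; suc)
open import Data.Fin.Properties using (all?; _≟_)
open import Relation.Nullary using (¬_)
open import Relation.Nullary.Decidable using (True; toWitness)
open import Data.List using (List; []; _∷_; _++_)
open import Data.List.Properties using (++-assoc)
open import Data.Product using (_,_)
open import Relation.Binary.PropositionalEquality using (_≡_; refl; sym; trans; cong; subst₂)
open import Data.List.Relation.Binary.Permutation.Propositional as P using (_↭_; ↭-reflexive)
open import Data.List.Relation.Binary.Permutation.Propositional.Properties using (shift; ++-comm; ++⁺ˡ; ++⁺ʳ; ∷↭∷ʳ)

-- Exchange side conditions compare the actions of two concrete permutations on
-- a concrete finite sequent; they are discharged by evaluation.
by-eval : ∀ {n m} {f g : Fin n → Fin m} {same : True (all? λ i → f i ≟ g i)} →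
          ∀ i → f i ≡ g i
by-eval {same = same} = toWitness same

infixr 5 _▸_
_▸_ : ∀ {Γ} {π ρ σ : ⊢ Γ} → π ≈ ρ → ρ ≈ σ → π ≈ σ
_▸_ = ≈-trans

≡⇒≈ : ∀ {Γ} {π ρ : ⊢ Γ} → π ≡ ρ → π ≈ ρ
≡⇒≈ refl = ≈-refl

ex-irr : ∀ {Γ Δ} (p q : Γ ↭ Δ) {π ρ : ⊢ Γ} → (∀ i → act p i ≡ act q i) → π ≈ ρ → ex p π ≈ ex q ρ
ex-irr p q {π} h e = ex-act p q π h ▸ ex-cong q e

ex-act-id : ∀ {Γ} (p : Γ ↭ Γ) (π : ⊢ Γ) → (∀ i → act p i ≡ i) → ex p π ≈ π
ex-act-id p π h = ex-act p P.refl π h ▸ ex-id π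

ex-ex-act : ∀ {Γ Δ Θ} (q : Γ ↭ Δ) (p : Δ ↭ Θ) (r : Γ ↭ Θ) (π : ⊢ Γ) →
            (∀ i → act p (act q i) ≡ act r i) → ex p (ex q π) ≈ ex r π
ex-ex-act q p r π h = ex-ex q p π ▸ ex-act (P.trans q p) r π h

ex-ex-id : ∀ {Γ Δ} (q : Γ ↭ Δ) (p : Δ ↭ Γ) (π : ⊢ Γ) →
           (∀ i → act p (act q i) ≡ i) → ex p (ex q π) ≈ π
ex-ex-id q p π h = ex-ex q p π ▸ ex-act-id (P.trans q p) π h

transport-cong : ∀ {X Y Γ} (e : X ≡ Y) {π ρ : ⊢ X ∷ Γ} → π ≈ ρ → transport e π ≈ transport e ρ
transport-cong refl h = h

transport-transport : ∀ {X Y Γ} (e₁ : X ≡ Y) (e₂ : Y ≡ X) (π : ⊢ X ∷ Γ) →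
                      transport e₂ (transport e₁ π) ≡ π
transport-transport refl refl π = refl

cut-transport : ∀ {X Y Γ Δ} (e : X ≡ Y) (π : ⊢ X ∷ Γ) (π' : ⊢ neg Y ∷ Δ) →
                cut Y (transport e π) π' ≡ cut X π (transport (cong neg (sym e)) π')
cut-transport refl π π' = refl

act-↭-sym : ∀ {Γ Δ : List Formula} (p : Γ ↭ Δ) i → act (P.↭-sym p) (act p i) ≡ i
act-↭-sym P.refl i = refl
act-↭-sym (P.prep x p) zero = refl
act-↭-sym (P.prep x p) (suc i) = cong suc (act-↭-sym p i)
act-↭-sym (P.swap x y p) zero = refl
act-↭-sym (P.swap x y p) (suc zero) = refl
act-↭-sym (P.swap x y p) (suc (suc i)) = cong (λ j → suc (suc j)) (act-↭-sym p i)
act-↭-sym (P.trans p q) i = trans (cong (act (P.↭-sym p)) (act-↭-sym q (act p i))) (act-↭-sym p i)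

ex-↭-sym : ∀ {Γ Δ} (p : Γ ↭ Δ) (π : ⊢ Γ) → ex (P.↭-sym p) (ex p π) ≈ π
ex-↭-sym p π = ex-ex-id p (P.↭-sym p) π (act-↭-sym p)

ex-transpose : ∀ {Γ Δ} (p : Γ ↭ Δ) {π : ⊢ Γ} {ρ : ⊢ Δ} → ex p π ≈ ρ → π ≈ ex (P.↭-sym p) ρ
ex-transpose p {π} h = ≈-sym (ex-↭-sym p π) ▸ ex-cong (P.↭-sym p) h

gcut-perm : ∀ (Σ₁ Σ₂ Δ : List Formula) → (Σ₁ ++ Σ₂) ++ Δ ↭ Σ₁ ++ Δ ++ Σ₂
gcut-perm Σ₁ Σ₂ Δ = P.trans (↭-reflexive (++-assoc Σ₁ Σ₂ Δ)) (++⁺ˡ Σ₁ (++-comm Σ₂ Δ))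

cut-sym-neg : ∀ {A Γ Δ} (Z : ⊢ A ∷ Γ) (π : ⊢ neg A ∷ Δ) →
  cut (neg A) π (transport (sym (neg-invol A)) Z) ≈ ex (++-comm Γ Δ) (cut A Z π)
cut-sym-neg {A} {Γ} {Δ} Z π =
  cut-sym π (transport (sym (neg-invol A)) Z)
  ▸ ex-cong _ (≡⇒≈ (trans (cut-transport (sym (neg-invol A)) Z _)
                   (cong (cut A Z) (transport-transport (sym (neg-invol (neg A))) (cong neg (sym (sym (neg-invol A)))) π))))

sw-gcut : ∀ {H C Δ} (R : ⊢ H ∷ C ∷ []) (π' : ⊢ neg C ∷ Δ) →
  cut C (ex sw R) π' ≈ ex (P.↭-sym (gcut-perm (H ∷ []) [] Δ)) (gcut (H ∷ []) R π')
sw-gcut R π' = ex-transpose _ (ex-cong _ (cut-cong _ (ex-act _ _ _ by-eval) ≈-refl))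

rotl : ∀ {x y z : Formula} → x ∷ y ∷ z ∷ [] ↭ y ∷ z ∷ x ∷ []
rotl {x} {y} {z} = P.trans (P.swap x y P.refl) (P.prep y (P.swap x z P.refl))

cut-ex-gcut : ∀ Σ₁ Σ₂ {C Γ' Δ} (p : Σ₁ ++ C ∷ Σ₂ ↭ C ∷ Γ') (r : Σ₁ ++ Σ₂ ↭ Γ')
  (Q : ⊢ Σ₁ ++ C ∷ Σ₂) (π' : ⊢ neg C ∷ Δ) →
  (∀ i → act p i ≡ act (P.prep C r) (act (shift C Σ₁ Σ₂) i)) →
  cut C (ex p Q) π' ≈ ex (++⁺ʳ Δ r) (ex (P.↭-sym (gcut-perm Σ₁ Σ₂ Δ)) (gcut Σ₁ Q π'))
cut-ex-gcut Σ₁ Σ₂ {C} {Γ'} {Δ} p r Q π' h =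
  cut-cong C (≈-trans (ex-act p (P.trans (shift C Σ₁ Σ₂) (P.prep C r)) Q h) (≈-sym (ex-ex _ _ Q))) ≈-refl
  ▸ exd-cutl r (ex (shift C Σ₁ Σ₂) Q) π'
  ▸ ex-cong _ (ex-transpose (gcut-perm Σ₁ Σ₂ Δ) ≈-refl)

gcut-cong : ∀ Σ₁ {C Σ₂ Δ} {Q Q' : ⊢ Σ₁ ++ C ∷ Σ₂} (π' : ⊢ neg C ∷ Δ) → Q ≈ Q' → gcut Σ₁ Q π' ≈ gcut Σ₁ Q' π'
gcut-cong Σ₁ {C} π' h = ex-cong _ (cut-cong C (ex-cong _ h) ≈-refl)

gcut-sw : ∀ {H C Δ} (g : ⊢ C ∷ H ∷ []) (W : ⊢ neg C ∷ Δ) →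
  gcut (H ∷ []) (ex sw g) W ≈ ex (gcut-perm (H ∷ []) [] Δ) (cut C g W)
gcut-sw {H} {C} g W = ex-cong _ (cut-cong C (ex-ex-id _ _ _ by-eval) ≈-refl)

gcut-rev3 : ∀ {H x y Δ} (U : ⊢ H ∷ x ∷ y ∷ []) (π' : ⊢ neg H ∷ Δ) →
  gcut (y ∷ x ∷ []) (ex rev3 U) π'
  ≈ ex (gcut-perm (y ∷ x ∷ []) [] Δ) (ex (++⁺ʳ Δ (P.swap x y P.refl)) (cut H U π'))
gcut-rev3 {H} {x} {y} U π' =
  ex-cong _ (cut-cong H (ex-ex-act _ _ (P.prep H (P.swap x y P.refl)) _ by-eval) ≈-refl ▸ exd-cutl _ _ _)

-- Formulas and proofs up to ≈ form a category with duality

Hom : Formula → Formula → Set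
Hom A B = ⊢ neg A ∷ B ∷ []

seq : ∀ {A B C} → Hom A B → Hom B C → Hom A C
seq {B = B} f g = cut B (ex sw f) g

seq-cong : ∀ {A B C} {f f' : Hom A B} {g g' : Hom B C} → f ≈ f' → g ≈ g' → seq f g ≈ seq f' g'
seq-cong {B = B} p q = cut-cong B (ex-cong sw p) q

swapped-ax : ∀ A → transport (sym (neg-invol A)) (ex sw (ax A)) ≈ ax (neg A)
swapped-ax A = transport-cong (sym (neg-invol A)) (ax-sym A)
             ▸ ≡⇒≈ (transport-transport (neg-invol A) (sym (neg-invol A)) (ax (neg A)))

cut-swapped-ax : ∀ {A Δ} (π : ⊢ neg A ∷ Δ) →
  (∀ i → act (++-comm Δ (neg A ∷ [])) (act (∷↭∷ʳ (neg A) Δ) i) ≡ i) →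
  cut A (ex sw (ax A)) π ≈ π
cut-swapped-ax {A} π h =
  cut-sym (ex sw (ax A)) π
  ▸ ex-cong _ (cut-cong (neg A) ≈-refl (swapped-ax A))
  ▸ ex-cong _ (cut-axr π)
  ▸ ex-ex-id _ _ π h

seq-identityˡ : ∀ {A B} (f : Hom A B) → seq (ax A) f ≈ f
seq-identityˡ f = cut-swapped-ax f by-eval

seq-assoc : ∀ {A B C D} (f : Hom A B) (g : Hom B C) (h : Hom C D) →
            seq (seq f g) h ≈ seq f (seq g h)
seq-assoc {A} {B} {C} {D} f g h =
  ≈-sym (ex-act-id _ _ by-eval)
  ▸ ex-cong _ (cut-cong C (≈-sym (ex-ex-act P.refl (shift C (neg A ∷ []) []) sw _ by-eval)) ≈-refl)
  ▸ com-cutr [] {B} {C} {[]} {neg A ∷ []} {D ∷ []} (ex sw f) g h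
  ▸ ex-cong P.refl (cut-cong B ≈-refl (ex-act-id _ _ by-eval))
  ▸ ex-id _
  ▸ cut-cong B ≈-refl (cut-cong C (ex-act _ _ _ by-eval) ≈-refl)

≅-refl : ∀ A → A ≅ A
≅-refl A = ax A , ax A , seq-identityˡ (ax A) , seq-identityˡ (ax A)

≅-sym : ∀ {A B} → A ≅ B → B ≅ A
≅-sym (f , g , p , q) = g , f , q , p

≅-trans : ∀ {A B C} → A ≅ B → B ≅ C → A ≅ C
≅-trans {A} {B} {C} (f₁ , g₁ , p₁ , q₁) (f₂ , g₂ , p₂ , q₂) =
  seq f₁ f₂ , seq g₂ g₁ , inverse f₁ f₂ g₂ g₁ p₂ p₁ , inverse g₂ g₁ f₁ f₂ q₁ q₂
  where
  inverse : ∀ {X Y Z} (f : Hom X Y) (f' : Hom Y Z) (g' : Hom Z Y) (g : Hom Y X) →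
            seq f' g' ≈ ax Y → seq f g ≈ ax X → seq (seq f f') (seq g' g) ≈ ax X
  inverse f f' g' g p' p =
    seq-assoc f f' (seq g' g)
    ▸ seq-cong ≈-refl (≈-sym (seq-assoc f' g' g))
    ▸ seq-cong ≈-refl (seq-cong p' ≈-refl)
    ▸ seq-cong ≈-refl (seq-identityˡ g)
    ▸ p

dual : ∀ {A B} → Hom A B → Hom (neg B) (neg A)
dual {A} {B} f = transport (sym (neg-invol B)) (ex sw f)

dual-cong : ∀ {A B} {f f' : Hom A B} → f ≈ f' → dual f ≈ dual f'
dual-cong {A} {B} p = transport-cong (sym (neg-invol B)) (ex-cong sw p)

dual-seq-transport : ∀ {A B C X} (e : C ≡ X) (f : Hom A B) (g : Hom B C) →
  ex (++-comm (neg A ∷ []) (X ∷ [])) (cut B (ex sw f) (ex sw (transport e (ex sw g))))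
  ≈ transport e (ex sw (cut B (ex sw f) g))
dual-seq-transport {B = B} refl f g =
  ex-irr _ sw by-eval (cut-cong B ≈-refl (ex-ex-id sw sw g by-eval))

dual-seq : ∀ {A B C} (f : Hom A B) (g : Hom B C) → seq (dual g) (dual f) ≈ dual (seq f g)
dual-seq {A} {B} {C} f g =
  cut-sym (ex sw (dual g)) (dual f)
  ▸ ex-cong _ (≡⇒≈ (trans (cut-transport (sym (neg-invol B)) (ex sw f) _)
      (cong (cut B (ex sw f))
        (transport-transport (sym (neg-invol (neg B))) (cong neg (sym (sym (neg-invol B)))) (ex sw (dual g))))))
  ▸ dual-seq-transport (sym (neg-invol C)) f g

neg-≅ : ∀ {A B} → A ≅ B → neg A ≅ neg B
neg-≅ {A} {B} (f , g , p , q) =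
  dual g , dual f ,
  (dual-seq f g ▸ dual-cong p ▸ swapped-ax A) ,
  (dual-seq g f ▸ dual-cong q ▸ swapped-ax B)

neg-≅⁻¹ : ∀ {A B} → neg A ≅ neg B → A ≅ B
neg-≅⁻¹ {A} {B} i = subst₂ _≅_ (neg-invol A) (neg-invol B) (neg-≅ i)

-- Extensionality for the negative connectives: η-expand the axiom cut against a
-- proof, then commute that cut up through the introduction rule of the axiom.

top-intro : ∀ Γ → ⊢ top ∷ Γ
top-intro Γ = ex (P.↭-sym (∷↭∷ʳ top Γ))
                 (ex (++-comm (top ∷ []) Γ)
                   (ex (P.↭-sym (gcut-perm (top ∷ []) [] Γ)) (top-r {Γ ++ []})))

top-η : ∀ {Γ} (Z : ⊢ top ∷ Γ) → Z ≈ top-intro Γ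
top-η {Γ} Z =
  ex-transpose (∷↭∷ʳ top Γ) (≈-sym (cut-axr Z))
  ▸ ex-cong _ (cut-cong top ≈-refl η-top)
  ▸ ex-cong _ (cut-sym Z (ex sw top-r))
  ▸ ex-cong _ (ex-cong _ (cut-cong nul (ex-act _ _ _ by-eval) ≈-refl))
  ▸ ex-cong _ (ex-cong _ (ex-transpose _ (com-top [] {nul} {[]} Z)))

top-unique : ∀ {Γ} (Z Z' : ⊢ top ∷ Γ) → Z ≈ Z'
top-unique Z Z' = ≈-trans (top-η Z) (≈-sym (top-η Z'))

bot-intro : ∀ Γ → ⊢ Γ ++ [] → ⊢ bot ∷ Γ
bot-intro Γ W = ex (P.↭-sym (∷↭∷ʳ bot Γ))
            (ex (++-comm (bot ∷ []) Γ)
              (ex (P.↭-sym (gcut-perm (bot ∷ []) [] Γ))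
                (bot-r (ex (gcut-perm [] [] Γ) (ex (P.↭-sym (++-comm [] Γ)) W)))))

bot-intro-cong : ∀ Γ {W W'} → W ≈ W' → bot-intro Γ W ≈ bot-intro Γ W'
bot-intro-cong Γ h = ex-cong _ (ex-cong _ (ex-cong _ (bot-cong (ex-cong _ (ex-cong _ h)))))

bot-η : ∀ {Γ} (Z : ⊢ bot ∷ Γ) → Z ≈ bot-intro Γ (cut bot Z one-r)
bot-η {Γ} Z =
  ex-transpose (∷↭∷ʳ bot Γ) (≈-sym (cut-axr Z))
  ▸ ex-cong _ (cut-cong bot ≈-refl η-bot)
  ▸ ex-cong _ (cut-sym Z (ex sw (bot-r one-r)))
  ▸ ex-cong _ (ex-cong _ (cut-cong one (ex-act _ _ _ by-eval) ≈-refl))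
  ▸ ex-cong _ (ex-cong _ (ex-transpose _ (com-bot [] {one} {[]} one-r Z)))
  ▸ ex-cong _ (ex-cong _ (ex-cong _ (bot-cong (ex-cong _ (cut-cong one (ex-id one-r) ≈-refl)))))
  ▸ ex-cong _ (ex-cong _ (ex-cong _ (bot-cong (ex-cong _ (ex-transpose _ (≈-sym (cut-sym Z one-r)))))))

bot-ext : ∀ {Γ} (Z Z' : ⊢ bot ∷ Γ) → cut bot Z one-r ≈ cut bot Z' one-r → Z ≈ Z'
bot-ext {Γ} Z Z' h = bot-η Z ▸ bot-intro-cong Γ h ▸ ≈-sym (bot-η Z')

with-intro : ∀ X Y Γ → ⊢ Γ ++ X ∷ [] → ⊢ Γ ++ Y ∷ [] → ⊢ (X & Y) ∷ Γ
with-intro X Y Γ W₁ W₂ =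
  ex (P.↭-sym (∷↭∷ʳ (X & Y) Γ))
   (ex (++-comm ((X & Y) ∷ []) Γ)
    (ex (P.↭-sym (gcut-perm ((X & Y) ∷ []) [] Γ))
     (with-r (ex (gcut-perm (X ∷ []) [] Γ) (ex (++-comm Γ (X ∷ [])) W₁))
             (ex (gcut-perm (Y ∷ []) [] Γ) (ex (++-comm Γ (Y ∷ [])) W₂)))))

with-intro-cong : ∀ X Y Γ {W₁ W₁' W₂ W₂'} → W₁ ≈ W₁' → W₂ ≈ W₂' → with-intro X Y Γ W₁ W₂ ≈ with-intro X Y Γ W₁' W₂'
with-intro-cong X Y Γ h₁ h₂ = ex-cong _ (ex-cong _ (ex-cong _ (with-cong (ex-cong _ (ex-cong _ h₁)) (ex-cong _ (ex-cong _ h₂)))))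

with-η : ∀ {X Y Γ} (Z : ⊢ (X & Y) ∷ Γ) →
  Z ≈ with-intro X Y Γ (cut (X & Y) Z (plus2-r (ax X))) (cut (X & Y) Z (plus1-r (ax Y)))
with-η {X} {Y} {Γ} Z =
  ex-transpose (∷↭∷ʳ (X & Y) Γ) (≈-sym (cut-axr Z))
  ▸ ex-cong _ (cut-cong (X & Y) ≈-refl (η-with X Y))
  ▸ ex-cong _ (cut-sym Z _)
  ▸ ex-cong _ (ex-cong _ (cut-cong _ (ex-act _ _ _ by-eval) ≈-refl))
  ▸ ex-cong _ (ex-cong _ (ex-transpose _ (com-with [] {X} {Y} {neg Y ⊕ neg X} {[]} _ _ _)))
  ▸ ex-cong _ (ex-cong _ (ex-cong _ (with-cong
       (ex-cong _ (cut-cong _ (ex-ex-id _ _ _ by-eval) ≈-refl ▸ cut-sym-neg Z _))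
       (ex-cong _ (cut-cong _ (ex-ex-id _ _ _ by-eval) ≈-refl ▸ cut-sym-neg Z _)))))

with-ext : ∀ {X Y Γ} (Z Z' : ⊢ (X & Y) ∷ Γ) →
  cut (X & Y) Z (plus2-r (ax X)) ≈ cut (X & Y) Z' (plus2-r (ax X)) →
  cut (X & Y) Z (plus1-r (ax Y)) ≈ cut (X & Y) Z' (plus1-r (ax Y)) → Z ≈ Z'
with-ext {X} {Y} {Γ} Z Z' h₁ h₂ = with-η Z ▸ with-intro-cong X Y Γ h₁ h₂ ▸ ≈-sym (with-η Z')

par-intro : ∀ X Y Γ → ⊢ Γ ++ Y ∷ X ∷ [] → ⊢ (X ⅋ Y) ∷ Γ
par-intro X Y Γ W =
  ex (P.↭-sym (∷↭∷ʳ (X ⅋ Y) Γ))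
   (ex (++-comm ((X ⅋ Y) ∷ []) Γ)
    (ex (P.↭-sym (gcut-perm ((X ⅋ Y) ∷ []) [] Γ))
     (par-r (ex (gcut-perm (X ∷ Y ∷ []) [] Γ)
              (ex (++⁺ʳ Γ (P.swap Y X P.refl))
                (ex (++-comm Γ (Y ∷ X ∷ [])) W))))))

par-intro-cong : ∀ X Y Γ {W W'} → W ≈ W' → par-intro X Y Γ W ≈ par-intro X Y Γ W'
par-intro-cong X Y Γ h = ex-cong _ (ex-cong _ (ex-cong _ (par-cong (ex-cong _ (ex-cong _ (ex-cong _ h))))))

par-η : ∀ {X Y Γ} (Z : ⊢ (X ⅋ Y) ∷ Γ) →
  Z ≈ par-intro X Y Γ (cut (X ⅋ Y) Z (tens-r (ax Y) (ax X)))
par-η {X} {Y} {Γ} Z =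
  ex-transpose (∷↭∷ʳ (X ⅋ Y) Γ) (≈-sym (cut-axr Z))
  ▸ ex-cong _ (cut-cong (X ⅋ Y) ≈-refl (η-par X Y))
  ▸ ex-cong _ (cut-sym Z _)
  ▸ ex-cong _ (ex-cong _ (cut-cong _ (ex-act _ _ _ by-eval) ≈-refl))
  ▸ ex-cong _ (ex-cong _ (ex-transpose _ (com-par [] {X} {Y} {neg Y ⊗ neg X} {[]} _ _)))
  ▸ ex-cong _ (ex-cong _ (ex-cong _ (par-cong (ex-cong _
       (cut-cong _ (ex-ex-act _ _ (P.prep (neg Y ⊗ neg X) (P.swap Y X P.refl)) _ by-eval) ≈-refl
        ▸ exd-cutl _ _ _
        ▸ ex-cong _ (cut-sym-neg Z _))))))

par-ext : ∀ {X Y Γ} (Z Z' : ⊢ (X ⅋ Y) ∷ Γ) →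
  cut (X ⅋ Y) Z (tens-r (ax Y) (ax X)) ≈ cut (X ⅋ Y) Z' (tens-r (ax Y) (ax X)) → Z ≈ Z'
par-ext {X} {Y} {Γ} Z Z' h = par-η Z ▸ par-intro-cong X Y Γ h ▸ ≈-sym (par-η Z')

key-par-ax : ∀ {X Y Γ} (V : ⊢ X ∷ Y ∷ Γ) →
  cut (X ⅋ Y) (par-r V) (tens-r (ax Y) (ax X))
  ≈ ex (P.trans (↭-reflexive (++-assoc Γ (X ∷ []) (Y ∷ []))) (++⁺ˡ Γ (++-comm (X ∷ []) (Y ∷ []))))
      (ex (∷↭∷ʳ Y (Γ ++ X ∷ [])) (ex (∷↭∷ʳ X (Y ∷ Γ)) V))
key-par-ax {X} {Y} {Γ} V =
  key-par V (ax Y) (ax X)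
  ▸ ex-cong _ (cut-cong Y (cut-axr V) ≈-refl ▸ cut-axr _)

key-with2-ax : ∀ {X Y Γ} (a : ⊢ X ∷ Γ) (b : ⊢ Y ∷ Γ) →
  cut (X & Y) (with-r a b) (plus2-r (ax X)) ≈ ex (∷↭∷ʳ X Γ) a
key-with2-ax a b = key-with2 a b _ ▸ cut-axr a

key-with1-ax : ∀ {X Y Γ} (a : ⊢ X ∷ Γ) (b : ⊢ Y ∷ Γ) →
  cut (X & Y) (with-r a b) (plus1-r (ax Y)) ≈ ex (∷↭∷ʳ Y Γ) b
key-with1-ax a b = key-with1 a b _ ▸ cut-axr b

-- Isomorphisms for ⊗ and ⊕

⊗-swap : ∀ A B → Hom (A ⊗ B) (B ⊗ A)
⊗-swap A B = par-r (ex rotl (tens-r (ex sw (ax B)) (ex sw (ax A))))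

⊗-swap-involutive : ∀ A B → seq (⊗-swap A B) (⊗-swap B A) ≈ ax (A ⊗ B)
⊗-swap-involutive A B =
  sw-gcut _ _
  ▸ ex-cong _ (com-par [] {neg B} {neg A} {B ⊗ A} {[]} _ _)
  ▸ ex-act-id _ _ by-eval
  ▸ par-cong (ex-cong _ (cut-cong _ (ex-ex-id _ _ _ by-eval) ≈-refl
     ▸ key-tens _ _ _
     ▸ ex-cong _ (cut-cong _ ≈-refl (ex-cong _ (cut-swapped-ax _ by-eval)) ▸ cut-swapped-ax _ by-eval)
     ) ▸ ex-ex _ _ _ ▸ ex-ex _ _ _ ▸ ex-ex-act _ _ rev3 _ by-eval)
  ▸ ≈-sym (η-tens A B)

⊗-comm-≅ : ∀ A B → (A ⊗ B) ≅ (B ⊗ A)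
⊗-comm-≅ A B = ⊗-swap A B , ⊗-swap B A , ⊗-swap-involutive A B , ⊗-swap-involutive B A

⊗-map : ∀ {A A' B B'} → Hom A A' → Hom B B' → Hom (A ⊗ B) (A' ⊗ B')
⊗-map f g = par-r (ex rev3 (tens-r (ex sw f) (ex sw g)))

⊗-map-cong : ∀ {A A' B B'} {f f' : Hom A A'} {g g' : Hom B B'} → f ≈ f' → g ≈ g' → ⊗-map f g ≈ ⊗-map f' g'
⊗-map-cong p q = par-cong (ex-cong _ (tens-cong (ex-cong _ p) (ex-cong _ q)))

⊗-map-seqʳ : ∀ {A' A'' B B' B''} (f' : Hom A' A'') (g : Hom B B') (g' : Hom B' B'') →
  cut B' (ex sw g) (ex rev3 (tens-r (ex sw f') (ex sw g')))
  ≈ ex rev3 (tens-r (ex sw f') (ex sw (seq g g')))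
⊗-map-seqʳ {A'} {A''} {B} {B'} {B''} f' g g' =
  cut-sym (ex sw g) _
  ▸ ex-cong _ (cut-ex-gcut ((A'' ⊗ B'') ∷ neg A' ∷ []) [] rev3 (P.swap _ _ P.refl) _ _ by-eval)
  ▸ ex-cong _ (ex-cong _ (ex-cong _ (gcut-cong ((A'' ⊗ B'') ∷ neg A' ∷ []) _ (≈-sym (ex-id _))
      ▸ com-tensr [] {A''} {B''} {neg B'} {[]} {neg A' ∷ []} (ex sw f') (ex sw g') _
      ▸ ex-id _
      ▸ tens-cong ≈-refl (gcut-sw g' _ ▸ ex-cong _ (cut-sym-neg (ex sw g) g') ▸ ex-ex-act _ _ sw _ by-eval))))
  ▸ ex-ex _ _ _ ▸ ex-ex-act _ _ rev3 _ by-eval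

⊗-map-seqˡ : ∀ {A A' A'' B B''} (f : Hom A A') (f' : Hom A' A'') (H : ⊢ B'' ∷ neg B ∷ []) →
  cut A' (ex sw f) (ex rotl (tens-r (ex sw f') H))
  ≈ ex rotl (tens-r (ex sw (seq f f')) H)
⊗-map-seqˡ {A} {A'} {A''} {B} {B''} f f' H =
  cut-sym (ex sw f) _
  ▸ ex-cong _ (cut-ex-gcut ((A'' ⊗ B'') ∷ []) (neg B ∷ []) rotl (P.swap _ _ P.refl) _ _ by-eval)
  ▸ ex-cong _ (ex-cong _ (ex-cong _ (gcut-cong ((A'' ⊗ B'') ∷ []) _ (≈-sym (ex-id _))
      ▸ com-tensl [] {A''} {B''} {neg A'} {[]} {neg B ∷ []} (ex sw f') H _
      ▸ ex-id _
      ▸ tens-cong (gcut-sw f' _ ▸ ex-cong _ (cut-sym-neg (ex sw f) f') ▸ ex-ex-act _ _ sw _ by-eval) ≈-refl)))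
  ▸ ex-ex _ _ _ ▸ ex-ex-act _ _ rotl _ by-eval

⊗-map-seq : ∀ {A A' A'' B B' B''} (f : Hom A A') (f' : Hom A' A'') (g : Hom B B') (g' : Hom B' B'') →
  seq (⊗-map f g) (⊗-map f' g') ≈ ⊗-map (seq f f') (seq g g')
⊗-map-seq {A} {A'} {A''} {B} {B'} {B''} f f' g g' =
  sw-gcut _ _
  ▸ ex-cong _ (com-par [] {neg B} {neg A} {A' ⊗ B'} {[]} _ _)
  ▸ ex-act-id _ _ by-eval
  ▸ par-cong (ex-cong _ (cut-cong _ (ex-ex-act _ _ (P.prep (A' ⊗ B') (P.swap (neg A) (neg B) P.refl)) _ by-eval) ≈-refl
     ▸ exd-cutl _ _ _
     ▸ ex-cong _ (key-tens _ _ _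
     ▸ ex-cong _ (cut-cong _ ≈-refl (ex-cong _ (⊗-map-seqʳ f' g g') ▸ ex-ex _ _ _ ▸ ex-act _ rotl _ by-eval)
                  ▸ ⊗-map-seqˡ f f' _)))
     ▸ ex-ex _ _ _ ▸ ex-ex _ _ _ ▸ ex-ex-act _ _ rev3 _ by-eval)

≅-⊗ : ∀ {A A' B B'} → A ≅ A' → B ≅ B' → (A ⊗ B) ≅ (A' ⊗ B')
≅-⊗ {A} {A'} {B} {B'} (f , f' , p , p') (g , g' , q , q') =
  ⊗-map f g , ⊗-map f' g' ,
  (⊗-map-seq f f' g g' ▸ ⊗-map-cong p q ▸ ≈-sym (η-tens A B)) ,
  (⊗-map-seq f' f g' g ▸ ⊗-map-cong p' q' ▸ ≈-sym (η-tens A' B'))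

⊕-map : ∀ {A A' B B'} → Hom A A' → Hom B B' → Hom (A ⊕ B) (A' ⊕ B')
⊕-map f g = with-r (ex sw (plus2-r (ex sw g))) (ex sw (plus1-r (ex sw f)))

⊕-map-cong : ∀ {A A' B B'} {f f' : Hom A A'} {g g' : Hom B B'} → f ≈ f' → g ≈ g' → ⊕-map f g ≈ ⊕-map f' g'
⊕-map-cong p q = with-cong (ex-cong _ (plus2-cong (ex-cong _ q))) (ex-cong _ (plus1-cong (ex-cong _ p)))

⊕-map-seq₂ : ∀ {A'' B B' B''} (g : Hom B B') (g' : Hom B' B'') →
  cut B' (ex sw g) (ex sw (plus2-r {A''} (ex sw g'))) ≈ ex sw (plus2-r (ex sw (seq g g')))
⊕-map-seq₂ {A''} {B} {B'} {B''} g g' =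
  cut-sym (ex sw g) _
  ▸ ex-cong _ (sw-gcut _ _)
  ▸ ex-cong _ (ex-cong _ (com-plus2 [] {A''} {B''} {neg B'} {[]} _ _
      ▸ plus2-cong (gcut-sw g' _ ▸ ex-cong _ (cut-sym-neg (ex sw g) g') ▸ ex-ex-act _ _ sw _ by-eval)))
  ▸ ex-ex _ _ _ ▸ ex-act _ _ _ by-eval

⊕-map-seq₁ : ∀ {A A' A'' B''} (f : Hom A A') (f' : Hom A' A'') →
  cut A' (ex sw f) (ex sw (plus1-r {_} {B''} (ex sw f'))) ≈ ex sw (plus1-r (ex sw (seq f f')))
⊕-map-seq₁ {A} {A'} {A''} {B''} f f' =
  cut-sym (ex sw f) _
  ▸ ex-cong _ (sw-gcut _ _)
  ▸ ex-cong _ (ex-cong _ (com-plus1 [] {A''} {B''} {neg A'} {[]} _ _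
      ▸ plus1-cong (gcut-sw f' _ ▸ ex-cong _ (cut-sym-neg (ex sw f) f') ▸ ex-ex-act _ _ sw _ by-eval)))
  ▸ ex-ex _ _ _ ▸ ex-act _ _ _ by-eval

⊕-map-seq : ∀ {A A' A'' B B' B''} (f : Hom A A') (f' : Hom A' A'') (g : Hom B B') (g' : Hom B' B'') →
  seq (⊕-map f g) (⊕-map f' g') ≈ ⊕-map (seq f f') (seq g g')
⊕-map-seq {A} {A'} {A''} {B} {B'} {B''} f f' g g' =
  sw-gcut _ _
  ▸ ex-cong _ (com-with [] {neg B} {neg A} {A' ⊕ B'} {[]} _ _ _)
  ▸ ex-act-id _ _ by-eval
  ▸ with-cong
      (gcut-sw _ _ ▸ ex-cong _ (key-plus2 _ _ _ ▸ ⊕-map-seq₂ g g') ▸ ex-ex-act _ _ sw _ by-eval)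
      (gcut-sw _ _ ▸ ex-cong _ (key-plus1 _ _ _ ▸ ⊕-map-seq₁ f f') ▸ ex-ex-act _ _ sw _ by-eval)

≅-⊕ : ∀ {A A' B B'} → A ≅ A' → B ≅ B' → (A ⊕ B) ≅ (A' ⊕ B')
≅-⊕ {A} {A'} {B} {B'} (f , f' , p , p') (g , g' , q , q') =
  ⊕-map f g , ⊕-map f' g' ,
  (⊕-map-seq f f' g g' ▸ ⊕-map-cong p q ▸ ≈-sym (η-plus A B)) ,
  (⊕-map-seq f' f g' g ▸ ⊕-map-cong p' q' ▸ ≈-sym (η-plus A' B'))

⊕-swap : ∀ A B → Hom (A ⊕ B) (B ⊕ A)
⊕-swap A B = with-r (ex sw (plus1-r (ex sw (ax B)))) (ex sw (plus2-r (ex sw (ax A))))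

⊕-swap-involutive : ∀ A B → seq (⊕-swap A B) (⊕-swap B A) ≈ ax (A ⊕ B)
⊕-swap-involutive A B =
  sw-gcut _ _
  ▸ ex-cong _ (com-with [] {neg B} {neg A} {B ⊕ A} {[]} _ _ _)
  ▸ ex-act-id _ _ by-eval
  ▸ with-cong
      (gcut-sw _ _ ▸ ex-cong _ (key-plus1 _ _ _ ▸ cut-swapped-ax _ by-eval) ▸ ex-act-id _ _ by-eval)
      (gcut-sw _ _ ▸ ex-cong _ (key-plus2 _ _ _ ▸ cut-swapped-ax _ by-eval) ▸ ex-act-id _ _ by-eval)
  ▸ ≈-sym (η-plus A B)

⊕-comm-≅ : ∀ A B → (A ⊕ B) ≅ (B ⊕ A)
⊕-comm-≅ A B = ⊕-swap A B , ⊕-swap B A , ⊕-swap-involutive A B , ⊕-swap-involutive B A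

⊕-identityʳ-≅ : ∀ A → (A ⊕ nul) ≅ A
⊕-identityʳ-≅ A = to , from , to-from , from-to
  where
  to : Hom (A ⊕ nul) A
  to = with-r top-r (ax A)
  from : Hom A (A ⊕ nul)
  from = ex sw (plus1-r (ex sw (ax A)))
  to-from : seq to from ≈ ax (A ⊕ nul)
  to-from = sw-gcut _ _
     ▸ ex-cong _ (com-with [] {top} {neg A} {A} {[]} _ _ _)
     ▸ ex-act-id _ _ by-eval
     ▸ with-cong (top-unique _ _)
         (gcut-cong (neg A ∷ []) _ (≈-sym (ex-ex-id sw sw _ by-eval)) ▸ gcut-sw _ _
          ▸ ex-cong _ (cut-swapped-ax _ by-eval) ▸ ex-act-id _ _ by-eval)
     ▸ ≈-sym (η-plus A nul)
  from-to : seq from to ≈ ax A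
  from-to = cut-cong _ (ex-ex-id _ _ _ by-eval) ≈-refl ▸ key-plus1 _ _ _ ▸ seq-identityˡ (ax A)

⊗-zeroʳ-≅ : ∀ A → (A ⊗ nul) ≅ nul
⊗-zeroʳ-≅ A = to , from , to-from , from-to
  where
  to : Hom (A ⊗ nul) nul
  to = par-r top-r
  from : Hom nul (A ⊗ nul)
  from = top-r
  to-from : seq to from ≈ ax (A ⊗ nul)
  to-from = sw-gcut _ _
     ▸ ex-cong _ (com-par [] {top} {neg A} {nul} {[]} _ _)
     ▸ ex-act-id _ _ by-eval
     ▸ par-cong (top-unique _ _)
     ▸ ≈-sym (η-tens A nul)
  from-to : seq from to ≈ ax nul
  from-to = top-unique _ _

⊗-identityʳ-≅ : ∀ A → (A ⊗ one) ≅ A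
⊗-identityʳ-≅ A = to , from , to-from , from-to
  where
  to : Hom (A ⊗ one) A
  to = par-r (bot-r (ax A))
  from : Hom A (A ⊗ one)
  from = ex sw (tens-r (ex sw (ax A)) one-r)
  ax-A⊗1-expanded : ⊢ bot ∷ neg A ∷ (A ⊗ one) ∷ []
  ax-A⊗1-expanded = ex rev3 (tens-r (ex sw (ax A)) (ex sw (ax one)))
  probe-from : cut bot (bot-r (ex (gcut-perm (neg A ∷ []) [] (A ⊗ one ∷ [])) from)) one-r
        ≈ ex (P.swap (A ⊗ one) (neg A) P.refl) (tens-r (ex sw (ax A)) one-r)
  probe-from = key-bot _ ▸ ex-ex _ _ _ ▸ ex-ex-act _ _ _ _ by-eval
  probe-expanded : cut bot ax-A⊗1-expanded one-r ≈ ex (P.swap (A ⊗ one) (neg A) P.refl) (tens-r (ex sw (ax A)) one-r)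
  probe-expanded = cut-ex-gcut ((A ⊗ one) ∷ neg A ∷ []) [] rev3 (P.swap _ _ P.refl) _ _ by-eval
      ▸ ex-cong _ (ex-cong _ (gcut-cong ((A ⊗ one) ∷ neg A ∷ []) _ (≈-sym (ex-id _))
         ▸ com-tensr [] {A} {one} {bot} {[]} {neg A ∷ []} (ex sw (ax A)) (ex sw (ax one)) one-r
         ▸ ex-id _
         ▸ tens-cong ≈-refl (gcut-sw _ _ ▸ ex-cong _ (cut-axl one-r) ▸ ex-act-id _ _ by-eval)))
      ▸ ex-ex _ _ _ ▸ ex-act _ _ _ by-eval
  to-from : seq to from ≈ ax (A ⊗ one)
  to-from = sw-gcut _ _
     ▸ ex-cong _ (com-par [] {bot} {neg A} {A} {[]} _ _)
     ▸ ex-act-id _ _ by-eval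
     ▸ par-cong (com-bot (neg A ∷ []) {A} {[]} (ax A) from
        ▸ bot-cong (gcut-cong (neg A ∷ []) _ (≈-sym (ex-ex-id sw sw _ by-eval)) ▸ gcut-sw _ _
                    ▸ ex-cong _ (cut-swapped-ax _ by-eval))
        ▸ bot-ext _ ax-A⊗1-expanded (probe-from ▸ ≈-sym probe-expanded))
     ▸ ≈-sym (η-tens A one)
  from-to : seq from to ≈ ax A
  from-to = cut-cong _ (ex-ex-id _ _ _ by-eval) ≈-refl
     ▸ key-tens _ _ _
     ▸ ex-cong _ (cut-cong A ≈-refl (ex-cong _ (key-one _) ▸ ex-id _))
     ▸ ex-id _
     ▸ seq-identityˡ (ax A)

-- Both round trips are identified with the identity by ⅋- and &-extensionality:
-- cut each side against the probing axioms and compute.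
module Distributivity (A B C : Formula) where
  S T : Formula
  S = (A ⊗ B) ⊕ (A ⊗ C)
  T = A ⊗ (B ⊕ C)

  VC : ⊢ (A ⊗ C) ∷ neg A ∷ neg C ∷ []
  VC = tens-r (ex sw (ax A)) (ex sw (ax C))

  VB : ⊢ (A ⊗ B) ∷ neg A ∷ neg B ∷ []
  VB = tens-r (ex sw (ax A)) (ex sw (ax B))

  dC : ⊢ neg C ∷ neg A ∷ S ∷ []
  dC = ex rev3 (plus2-r {A ⊗ B} VC)

  dB : ⊢ neg B ∷ neg A ∷ S ∷ []
  dB = ex rev3 (plus1-r {_} {A ⊗ C} VB)

  distribute : Hom T S
  distribute = par-r (with-r dC dB)

  UC : ⊢ T ∷ neg A ∷ neg C ∷ []
  UC = tens-r (ex sw (ax A)) (plus2-r {B} (ex sw (ax C)))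

  UB : ⊢ T ∷ neg A ∷ neg B ∷ []
  UB = tens-r (ex sw (ax A)) (plus1-r {_} {C} (ex sw (ax B)))

  eC : ⊢ neg C ∷ neg A ∷ T ∷ []
  eC = ex rev3 UC

  eB : ⊢ neg B ∷ neg A ∷ T ∷ []
  eB = ex rev3 UB

  factor : Hom S T
  factor = with-r (par-r eC) (par-r eB)

  probeC : ⊢ neg (neg C ⅋ neg A) ∷ neg A ∷ neg C ∷ []
  probeC = tens-r (ax (neg A)) (ax (neg C))

  probeB : ⊢ neg (neg B ⅋ neg A) ∷ neg A ∷ neg B ∷ []
  probeB = tens-r (ax (neg A)) (ax (neg B))

  fd-lhsC : cut (neg C ⅋ neg A) (par-r (gcut (neg C ∷ neg A ∷ []) eC distribute)) probeC ≈ plus2-r VC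
  fd-lhsC = key-par-ax _
    ▸ ex-cong _ (ex-cong _ (ex-cong _ (gcut-rev3 UC distribute ▸ ex-cong _ (ex-cong _ (
         key-tens _ _ _ ▸ ex-cong _ (cut-cong A ≈-refl (ex-cong _ (key-plus2 _ _ _ ▸ cut-swapped-ax _ by-eval)) ▸ cut-swapped-ax _ by-eval))))))
    ▸ ex-ex _ _ _ ▸ ex-ex _ _ _ ▸ ex-ex _ _ _ ▸ ex-ex _ _ _ ▸ ex-ex _ _ _ ▸ ex-ex _ _ _ ▸ ex-ex _ _ _
    ▸ ex-act-id _ _ by-eval

  fd-rhsC : cut (neg C ⅋ neg A) (ex sw (plus2-r {A ⊗ B} (ex sw (ax (A ⊗ C))))) probeC ≈ plus2-r VC
  fd-rhsC = cut-cong _ (ex-cong _ (plus2-cong (ex-cong _ (η-tens A C)))) ≈-refl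
    ▸ sw-gcut _ _
    ▸ ex-cong _ (com-plus2 [] {A ⊗ B} {A ⊗ C} {neg C ⅋ neg A} {[]} _ _
       ▸ plus2-cong (gcut-sw _ _ ▸ ex-cong _ (key-par-ax _)
          ▸ ex-ex _ _ _ ▸ ex-ex _ _ _ ▸ ex-ex _ _ _ ▸ ex-ex _ _ _ ▸ ex-act-id _ _ by-eval))
    ▸ ex-act-id _ _ by-eval

  fd-lhsB : cut (neg B ⅋ neg A) (par-r (gcut (neg B ∷ neg A ∷ []) eB distribute)) probeB ≈ plus1-r VB
  fd-lhsB = key-par-ax _
    ▸ ex-cong _ (ex-cong _ (ex-cong _ (gcut-rev3 UB distribute ▸ ex-cong _ (ex-cong _ (
         key-tens _ _ _ ▸ ex-cong _ (cut-cong A ≈-refl (ex-cong _ (key-plus1 _ _ _ ▸ cut-swapped-ax _ by-eval)) ▸ cut-swapped-ax _ by-eval))))))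
    ▸ ex-ex _ _ _ ▸ ex-ex _ _ _ ▸ ex-ex _ _ _ ▸ ex-ex _ _ _ ▸ ex-ex _ _ _ ▸ ex-ex _ _ _ ▸ ex-ex _ _ _
    ▸ ex-act-id _ _ by-eval

  fd-rhsB : cut (neg B ⅋ neg A) (ex sw (plus1-r {_} {A ⊗ C} (ex sw (ax (A ⊗ B))))) probeB ≈ plus1-r VB
  fd-rhsB = cut-cong _ (ex-cong _ (plus1-cong (ex-cong _ (η-tens A B)))) ≈-refl
    ▸ sw-gcut _ _
    ▸ ex-cong _ (com-plus1 [] {A ⊗ B} {A ⊗ C} {neg B ⅋ neg A} {[]} _ _
       ▸ plus1-cong (gcut-sw _ _ ▸ ex-cong _ (key-par-ax _)
          ▸ ex-ex _ _ _ ▸ ex-ex _ _ _ ▸ ex-ex _ _ _ ▸ ex-ex _ _ _ ▸ ex-act-id _ _ by-eval))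
    ▸ ex-act-id _ _ by-eval

  factor-distribute : seq factor distribute ≈ ax S
  factor-distribute = sw-gcut _ _
    ▸ ex-cong _ (com-with [] {neg C ⅋ neg A} {neg B ⅋ neg A} {T} {[]} _ _ _)
    ▸ ex-act-id _ _ by-eval
    ▸ with-cong (com-par [] {neg C} {neg A} {T} {[]} eC distribute ▸ par-ext _ _ (fd-lhsC ▸ ≈-sym fd-rhsC))
                (com-par [] {neg B} {neg A} {T} {[]} eB distribute ▸ par-ext _ _ (fd-lhsB ▸ ≈-sym fd-rhsB))
    ▸ ≈-sym (η-plus (A ⊗ B) (A ⊗ C))

  ax-B⊕C-expanded : ⊢ (neg C & neg B) ∷ (B ⊕ C) ∷ []
  ax-B⊕C-expanded = with-r (ex sw (plus2-r {B} (ex sw (ax C)))) (ex sw (plus1-r {_} {C} (ex sw (ax B))))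

  ax-T-expanded : ⊢ (neg C & neg B) ∷ neg A ∷ T ∷ []
  ax-T-expanded = ex rev3 (tens-r (ex sw (ax A)) (ex sw ax-B⊕C-expanded))

  df-lhsC : cut (neg C & neg B) (with-r (gcut (neg C ∷ neg A ∷ []) dC factor) (gcut (neg B ∷ neg A ∷ []) dB factor))
           (plus2-r (ax (neg C)))
       ≈ ex (P.swap T (neg A) P.refl) UC
  df-lhsC = key-with2-ax _ _
    ▸ ex-cong _ (gcut-rev3 (plus2-r VC) factor ▸ ex-cong _ (ex-cong _ (key-plus2 _ _ _ ▸ key-tens _ _ _
         ▸ ex-cong _ (cut-cong A ≈-refl (ex-cong _ (cut-swapped-ax _ by-eval)) ▸ cut-swapped-ax _ by-eval))))
    ▸ ex-ex _ _ _ ▸ ex-ex _ _ _ ▸ ex-ex _ _ _ ▸ ex-ex _ _ _ ▸ ex-ex _ _ _ ▸ ex-act _ _ _ by-eval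

  df-rhsC : cut (neg C & neg B) ax-T-expanded (plus2-r (ax (neg C))) ≈ ex (P.swap T (neg A) P.refl) UC
  df-rhsC = cut-ex-gcut (T ∷ neg A ∷ []) [] rev3 (P.swap _ _ P.refl) _ _ by-eval
    ▸ ex-cong _ (ex-cong _ (gcut-cong (T ∷ neg A ∷ []) _ (≈-sym (ex-id _))
       ▸ com-tensr [] {A} {B ⊕ C} {neg C & neg B} {[]} {neg A ∷ []} (ex sw (ax A)) (ex sw ax-B⊕C-expanded) _
       ▸ ex-id _
       ▸ tens-cong ≈-refl (gcut-sw _ _ ▸ ex-cong _ (key-with2-ax _ _) ▸ ex-ex _ _ _ ▸ ex-ex _ _ _ ▸ ex-act-id _ _ by-eval)))
    ▸ ex-ex _ _ _ ▸ ex-act _ _ _ by-eval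

  df-lhsB : cut (neg C & neg B) (with-r (gcut (neg C ∷ neg A ∷ []) dC factor) (gcut (neg B ∷ neg A ∷ []) dB factor))
           (plus1-r (ax (neg B)))
       ≈ ex (P.swap T (neg A) P.refl) UB
  df-lhsB = key-with1-ax _ _
    ▸ ex-cong _ (gcut-rev3 (plus1-r VB) factor ▸ ex-cong _ (ex-cong _ (key-plus1 _ _ _ ▸ key-tens _ _ _
         ▸ ex-cong _ (cut-cong A ≈-refl (ex-cong _ (cut-swapped-ax _ by-eval)) ▸ cut-swapped-ax _ by-eval))))
    ▸ ex-ex _ _ _ ▸ ex-ex _ _ _ ▸ ex-ex _ _ _ ▸ ex-ex _ _ _ ▸ ex-ex _ _ _ ▸ ex-act _ _ _ by-eval

  df-rhsB : cut (neg C & neg B) ax-T-expanded (plus1-r (ax (neg B))) ≈ ex (P.swap T (neg A) P.refl) UB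
  df-rhsB = cut-ex-gcut (T ∷ neg A ∷ []) [] rev3 (P.swap _ _ P.refl) _ _ by-eval
    ▸ ex-cong _ (ex-cong _ (gcut-cong (T ∷ neg A ∷ []) _ (≈-sym (ex-id _))
       ▸ com-tensr [] {A} {B ⊕ C} {neg C & neg B} {[]} {neg A ∷ []} (ex sw (ax A)) (ex sw ax-B⊕C-expanded) _
       ▸ ex-id _
       ▸ tens-cong ≈-refl (gcut-sw _ _ ▸ ex-cong _ (key-with1-ax _ _) ▸ ex-ex _ _ _ ▸ ex-ex _ _ _ ▸ ex-act-id _ _ by-eval)))
    ▸ ex-ex _ _ _ ▸ ex-act _ _ _ by-eval

  distribute-factor : seq distribute factor ≈ ax T
  distribute-factor = sw-gcut _ _
    ▸ ex-cong _ (com-par [] {neg C & neg B} {neg A} {S} {[]} _ _)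
    ▸ ex-act-id _ _ by-eval
    ▸ par-cong (com-with (neg A ∷ []) {neg C} {neg B} {S} {[]} dC dB factor
                ▸ with-ext _ ax-T-expanded (df-lhsC ▸ ≈-sym df-rhsC) (df-lhsB ▸ ≈-sym df-rhsB))
    ▸ ≈-sym (η-tens A (B ⊕ C) ▸ par-cong (ex-cong _ (tens-cong ≈-refl (ex-cong _ (η-plus B C)))))

⊗-distribˡ-⊕-≅ : ∀ A B C → (A ⊗ (B ⊕ C)) ≅ ((A ⊗ B) ⊕ (A ⊗ C))
⊗-distribˡ-⊕-≅ A B C = distribute , factor , distribute-factor , factor-distribute
  where open Distributivity A B C

-- The axioms of E other than associativity; normalisation never reassociates, so
-- only these have to be realised by isomorphisms.
data AxNF : Formula → Formula → Set where
  s⊗comm  : ∀ A B → AxNF (A ⊗ B) (B ⊗ A)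
  s⅋comm  : ∀ A B → AxNF (A ⅋ B) (B ⅋ A)
  s⊕comm  : ∀ A B → AxNF (A ⊕ B) (B ⊕ A)
  s&comm  : ∀ A B → AxNF (A & B) (B & A)
  s⊗distr : ∀ A B C → AxNF (A ⊗ (B ⊕ C)) ((A ⊗ B) ⊕ (A ⊗ C))
  s⅋distr : ∀ A B C → AxNF (A ⅋ (B & C)) ((A ⅋ B) & (A ⅋ C))
  s⊗unit  : ∀ A → AxNF (A ⊗ one) A
  s⅋unit  : ∀ A → AxNF (A ⅋ bot) A
  s⊕unit  : ∀ A → AxNF (A ⊕ nul) A
  s&unit  : ∀ A → AxNF (A & top) A
  s⊗zero  : ∀ A → AxNF (A ⊗ nul) nul
  s⅋zero  : ∀ A → AxNF (A ⅋ top) top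

_=NF_ : Formula → Formula → Set
_=NF_ = Cong AxNF

Cong-map : ∀ {Ax Ax' : Formula → Formula → Set} → (∀ {X Y} → Ax X Y → Cong Ax' X Y) →
          ∀ {X Y} → Cong Ax X Y → Cong Ax' X Y
Cong-map f (axiom a) = f a
Cong-map f refl' = refl'
Cong-map f (sym' c) = sym' (Cong-map f c)
Cong-map f (trans' c d) = trans' (Cong-map f c) (Cong-map f d)
Cong-map f (⊗-cong c d) = ⊗-cong (Cong-map f c) (Cong-map f d)
Cong-map f (⅋-cong c d) = ⅋-cong (Cong-map f c) (Cong-map f d)
Cong-map f (&-cong c d) = &-cong (Cong-map f c) (Cong-map f d)
Cong-map f (⊕-cong c d) = ⊕-cong (Cong-map f c) (Cong-map f d)

AxNF⇒=E : ∀ {X Y} → AxNF X Y → X =E Y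
AxNF⇒=E (s⊗comm A B) = axiom (ac (⊗-comm A B))
AxNF⇒=E (s⅋comm A B) = axiom (ac (⅋-comm A B))
AxNF⇒=E (s⊕comm A B) = axiom (ac (⊕-comm A B))
AxNF⇒=E (s&comm A B) = axiom (ac (&-comm A B))
AxNF⇒=E (s⊗distr A B C) = axiom (⊗-distr A B C)
AxNF⇒=E (s⅋distr A B C) = axiom (⅋-distr A B C)
AxNF⇒=E (s⊗unit A) = axiom (⊗-unit A)
AxNF⇒=E (s⅋unit A) = axiom (⅋-unit A)
AxNF⇒=E (s⊕unit A) = axiom (⊕-unit A)
AxNF⇒=E (s&unit A) = axiom (&-unit A)
AxNF⇒=E (s⊗zero A) = axiom (⊗-zero A)
AxNF⇒=E (s⅋zero A) = axiom (⅋-zero A)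

=NF⇒=E : ∀ {X Y} → X =NF Y → X =E Y
=NF⇒=E = Cong-map AxNF⇒=E

=AC⇒=E : ∀ {X Y} → X =AC Y → X =E Y
=AC⇒=E = Cong-map (λ a → axiom (ac a))

AxNF⇒≅ : ∀ {X Y} → AxNF X Y → X ≅ Y
AxNF⇒≅ (s⊗comm A B) = ⊗-comm-≅ A B
AxNF⇒≅ (s⅋comm A B) = neg-≅⁻¹ (⊗-comm-≅ (neg B) (neg A))
AxNF⇒≅ (s⊕comm A B) = ⊕-comm-≅ A B
AxNF⇒≅ (s&comm A B) = neg-≅⁻¹ (⊕-comm-≅ (neg B) (neg A))
AxNF⇒≅ (s⊗distr A B C) = ⊗-distribˡ-⊕-≅ A B C
AxNF⇒≅ (s⅋distr A B C) = neg-≅⁻¹ (≅-trans (⊗-comm-≅ _ _)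
  (≅-trans (⊗-distribˡ-⊕-≅ (neg A) (neg C) (neg B)) (≅-⊕ (⊗-comm-≅ _ _) (⊗-comm-≅ _ _))))
AxNF⇒≅ (s⊗unit A) = ⊗-identityʳ-≅ A
AxNF⇒≅ (s⅋unit A) = neg-≅⁻¹ (≅-trans (⊗-comm-≅ one (neg A)) (⊗-identityʳ-≅ (neg A)))
AxNF⇒≅ (s⊕unit A) = ⊕-identityʳ-≅ A
AxNF⇒≅ (s&unit A) = neg-≅⁻¹ (≅-trans (⊕-comm-≅ nul (neg A)) (⊕-identityʳ-≅ (neg A)))
AxNF⇒≅ (s⊗zero A) = ⊗-zeroʳ-≅ A
AxNF⇒≅ (s⅋zero A) = neg-≅⁻¹ (≅-trans (⊗-comm-≅ nul (neg A)) (⊗-zeroʳ-≅ (neg A)))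

=NF⇒≅ : ∀ {X Y} → X =NF Y → X ≅ Y
=NF⇒≅ (axiom a) = AxNF⇒≅ a
=NF⇒≅ refl' = ≅-refl _
=NF⇒≅ (sym' c) = ≅-sym (=NF⇒≅ c)
=NF⇒≅ (trans' c d) = ≅-trans (=NF⇒≅ c) (=NF⇒≅ d)
=NF⇒≅ (⊗-cong c d) = ≅-⊗ (=NF⇒≅ c) (=NF⇒≅ d)
=NF⇒≅ (⅋-cong c d) = neg-≅⁻¹ (≅-⊗ (neg-≅ (=NF⇒≅ d)) (neg-≅ (=NF⇒≅ c)))
=NF⇒≅ (&-cong c d) = neg-≅⁻¹ (≅-⊕ (neg-≅ (=NF⇒≅ d)) (neg-≅ (=NF⇒≅ c)))
=NF⇒≅ (⊕-cong c d) = ≅-⊕ (=NF⇒≅ c) (=NF⇒≅ d)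

-- Distributed normal forms

data ⊗-Factor : Formula → Set where
  pv : ∀ n → ⊗-Factor (var n)
  pc : ∀ n → ⊗-Factor (covar n)
  p⊗ : ∀ A B → ⊗-Factor (A ⊗ B)
  p⅋ : ∀ A B → ⊗-Factor (A ⅋ B)
  pb : ⊗-Factor bot
  p& : ∀ A B → ⊗-Factor (A & B)
  pt : ⊗-Factor top

data ⊗-View : Formula → Set where
  v⊕ : ∀ A B → ⊗-View (A ⊕ B)
  v0 : ⊗-View nul
  v1 : ⊗-View one
  vp : ∀ {X} → ⊗-Factor X → ⊗-View X

view⊗ : ∀ X → ⊗-View X
view⊗ (var n) = vp (pv n)
view⊗ (covar n) = vp (pc n)
view⊗ (A ⊗ B) = vp (p⊗ A B)
view⊗ (A ⅋ B) = vp (p⅋ A B)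
view⊗ one = v1
view⊗ bot = vp pb
view⊗ (A & B) = vp (p& A B)
view⊗ (A ⊕ B) = v⊕ A B
view⊗ top = vp pt
view⊗ nul = v0

data ⅋-Factor : Formula → Set where
  qv : ∀ n → ⅋-Factor (var n)
  qc : ∀ n → ⅋-Factor (covar n)
  q⊗ : ∀ A B → ⅋-Factor (A ⊗ B)
  q⅋ : ∀ A B → ⅋-Factor (A ⅋ B)
  qo : ⅋-Factor one
  q⊕ : ∀ A B → ⅋-Factor (A ⊕ B)
  qn : ⅋-Factor nul

data ⅋-View : Formula → Set where
  w& : ∀ A B → ⅋-View (A & B)
  wt : ⅋-View top
  wb : ⅋-View bot
  wp : ∀ {X} → ⅋-Factor X → ⅋-View X

view⅋ : ∀ X → ⅋-View X
view⅋ (var n) = wp (qv n)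
view⅋ (covar n) = wp (qc n)
view⅋ (A ⊗ B) = wp (q⊗ A B)
view⅋ (A ⅋ B) = wp (q⅋ A B)
view⅋ one = wp qo
view⅋ bot = wb
view⅋ (A & B) = w& A B
view⅋ (A ⊕ B) = wp (q⊕ A B)
view⅋ top = wt
view⅋ nul = wp qn

data NotNul : Formula → Set where
  nv : ∀ n → NotNul (var n)
  nc : ∀ n → NotNul (covar n)
  n⊗ : ∀ A B → NotNul (A ⊗ B)
  n⅋ : ∀ A B → NotNul (A ⅋ B)
  no : NotNul one
  nb : NotNul bot
  n& : ∀ A B → NotNul (A & B)
  n⊕ : ∀ A B → NotNul (A ⊕ B)
  nt : NotNul top

data NulView : Formula → Set where
  isnul : NulView nul
  notnul : ∀ {X} → NotNul X → NulView X

viewN : ∀ X → NulView X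
viewN (var n) = notnul (nv n)
viewN (covar n) = notnul (nc n)
viewN (A ⊗ B) = notnul (n⊗ A B)
viewN (A ⅋ B) = notnul (n⅋ A B)
viewN one = notnul no
viewN bot = notnul nb
viewN (A & B) = notnul (n& A B)
viewN (A ⊕ B) = notnul (n⊕ A B)
viewN top = notnul nt
viewN nul = isnul

data NotTop : Formula → Set where
  tv : ∀ n → NotTop (var n)
  tc : ∀ n → NotTop (covar n)
  t⊗ : ∀ A B → NotTop (A ⊗ B)
  t⅋ : ∀ A B → NotTop (A ⅋ B)
  to : NotTop one
  tb : NotTop bot
  t& : ∀ A B → NotTop (A & B)
  t⊕ : ∀ A B → NotTop (A ⊕ B)
  tn : NotTop nul

data TopView : Formula → Set where
  istop : TopView top
  nottop : ∀ {X} → NotTop X → TopView X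

viewT : ∀ X → TopView X
viewT (var n) = nottop (tv n)
viewT (covar n) = nottop (tc n)
viewT (A ⊗ B) = nottop (t⊗ A B)
viewT (A ⅋ B) = nottop (t⅋ A B)
viewT one = nottop to
viewT bot = nottop tb
viewT (A & B) = nottop (t& A B)
viewT (A ⊕ B) = nottop (t⊕ A B)
viewT top = istop
viewT nul = nottop tn

plus-nf : Formula → Formula → Formula
plus-nf X Y with viewN X | viewN Y
... | isnul | _ = Y
... | notnul _ | isnul = X
... | notnul _ | notnul _ = X ⊕ Y

with-nf : Formula → Formula → Formula
with-nf X Y with viewT X | viewT Y
... | istop | _ = Y
... | nottop _ | istop = X
... | nottop _ | nottop _ = X & Y

tens-nfʳ : Formula → Formula → Formula
tens-nfʳ X Y with view⊗ Y
... | v⊕ A B = plus-nf (tens-nfʳ X A) (tens-nfʳ X B)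
... | v0 = nul
... | v1 = X
... | vp _ = X ⊗ Y

tens-nf : Formula → Formula → Formula
tens-nf X Y with view⊗ X
... | v⊕ A B = plus-nf (tens-nf A Y) (tens-nf B Y)
... | v0 = nul
... | v1 = Y
... | vp _ = tens-nfʳ X Y

par-nfʳ : Formula → Formula → Formula
par-nfʳ X Y with view⅋ Y
... | w& A B = with-nf (par-nfʳ X A) (par-nfʳ X B)
... | wt = top
... | wb = X
... | wp _ = X ⅋ Y

par-nf : Formula → Formula → Formula
par-nf X Y with view⅋ X
... | w& A B = with-nf (par-nf A Y) (par-nf B Y)
... | wt = top
... | wb = Y
... | wp _ = par-nfʳ X Y

nf : Formula → Formula
nf (var n) = var n
nf (covar n) = covar n
nf (A ⊗ B) = tens-nf (nf A) (nf B)
nf (A ⅋ B) = par-nf (nf A) (nf B)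
nf one = one
nf bot = bot
nf (A & B) = with-nf (nf A) (nf B)
nf (A ⊕ B) = plus-nf (nf A) (nf B)
nf top = top
nf nul = nul

plus-nf-correct : ∀ X Y → plus-nf X Y =NF (X ⊕ Y)
plus-nf-correct X Y with viewN X | viewN Y
... | isnul | _ = sym' (trans' (axiom (s⊕comm nul Y)) (axiom (s⊕unit Y)))
... | notnul _ | isnul = sym' (axiom (s⊕unit X))
... | notnul _ | notnul _ = refl'

with-nf-correct : ∀ X Y → with-nf X Y =NF (X & Y)
with-nf-correct X Y with viewT X | viewT Y
... | istop | _ = sym' (trans' (axiom (s&comm top Y)) (axiom (s&unit Y)))
... | nottop _ | istop = sym' (axiom (s&unit X))
... | nottop _ | nottop _ = refl'

tens-nfʳ-correct : ∀ X Y → tens-nfʳ X Y =NF (X ⊗ Y)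
tens-nfʳ-correct X Y with view⊗ Y
... | v⊕ A B = trans' (plus-nf-correct _ _) (trans' (⊕-cong (tens-nfʳ-correct X A) (tens-nfʳ-correct X B)) (sym' (axiom (s⊗distr X A B))))
... | v0 = sym' (axiom (s⊗zero X))
... | v1 = sym' (axiom (s⊗unit X))
... | vp _ = refl'

tens-nf-correct : ∀ X Y → tens-nf X Y =NF (X ⊗ Y)
tens-nf-correct X Y with view⊗ X
... | v⊕ A B = trans' (plus-nf-correct _ _) (trans' (⊕-cong (tens-nf-correct A Y) (tens-nf-correct B Y))
                 (trans' (⊕-cong (axiom (s⊗comm A Y)) (axiom (s⊗comm B Y)))
                 (trans' (sym' (axiom (s⊗distr Y A B))) (axiom (s⊗comm Y (A ⊕ B))))))
... | v0 = trans' (sym' (axiom (s⊗zero Y))) (axiom (s⊗comm Y nul))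
... | v1 = trans' (sym' (axiom (s⊗unit Y))) (axiom (s⊗comm Y one))
... | vp _ = tens-nfʳ-correct X Y

par-nfʳ-correct : ∀ X Y → par-nfʳ X Y =NF (X ⅋ Y)
par-nfʳ-correct X Y with view⅋ Y
... | w& A B = trans' (with-nf-correct _ _) (trans' (&-cong (par-nfʳ-correct X A) (par-nfʳ-correct X B)) (sym' (axiom (s⅋distr X A B))))
... | wt = sym' (axiom (s⅋zero X))
... | wb = sym' (axiom (s⅋unit X))
... | wp _ = refl'

par-nf-correct : ∀ X Y → par-nf X Y =NF (X ⅋ Y)
par-nf-correct X Y with view⅋ X
... | w& A B = trans' (with-nf-correct _ _) (trans' (&-cong (par-nf-correct A Y) (par-nf-correct B Y))
                 (trans' (&-cong (axiom (s⅋comm A Y)) (axiom (s⅋comm B Y)))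
                 (trans' (sym' (axiom (s⅋distr Y A B))) (axiom (s⅋comm Y (A & B))))))
... | wt = trans' (sym' (axiom (s⅋zero Y))) (axiom (s⅋comm Y top))
... | wb = trans' (sym' (axiom (s⅋unit Y))) (axiom (s⅋comm Y bot))
... | wp _ = par-nfʳ-correct X Y

nf-correct : ∀ A → nf A =NF A
nf-correct (var n) = refl'
nf-correct (covar n) = refl'
nf-correct (A ⊗ B) = trans' (tens-nf-correct _ _) (⊗-cong (nf-correct A) (nf-correct B))
nf-correct (A ⅋ B) = trans' (par-nf-correct _ _) (⅋-cong (nf-correct A) (nf-correct B))
nf-correct one = refl'
nf-correct bot = refl'
nf-correct (A & B) = trans' (with-nf-correct _ _) (&-cong (nf-correct A) (nf-correct B))
nf-correct (A ⊕ B) = trans' (plus-nf-correct _ _) (⊕-cong (nf-correct A) (nf-correct B))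
nf-correct top = refl'
nf-correct nul = refl'

&-distributedˡ : ∀ {A B} → Distributed (A & B) → Distributed A
&-distributedˡ d C s = d C (&l s)
&-distributedʳ : ∀ {A B} → Distributed (A & B) → Distributed B
&-distributedʳ d C s = d C (&r s)
⊕-distributedˡ : ∀ {A B} → Distributed (A ⊕ B) → Distributed A
⊕-distributedˡ d C s = d C (⊕l s)
⊕-distributedʳ : ∀ {A B} → Distributed (A ⊕ B) → Distributed B
⊕-distributedʳ d C s = d C (⊕r s)

var-distributed : ∀ n → Distributed (var n)
var-distributed n _ here ()
covar-distributed : ∀ n → Distributed (covar n)
covar-distributed n _ here ()
one-distributed : Distributed one
one-distributed _ here ()
bot-distributed : Distributed bot
bot-distributed _ here ()
top-distributed : Distributed top
top-distributed _ here ()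
nul-distributed : Distributed nul
nul-distributed _ here ()

¬Bad-⊕ : ∀ {X Y} → NotNul X → NotNul Y → ¬ Bad (X ⊕ Y)
¬Bad-⊕ p () (b5 _)
¬Bad-⊕ () q (b6 _)

⊕-distributed : ∀ {X Y} → NotNul X → NotNul Y → Distributed X → Distributed Y → Distributed (X ⊕ Y)
⊕-distributed p q dX dY _ here b = ¬Bad-⊕ p q b
⊕-distributed p q dX dY C (⊕l s) = dX C s
⊕-distributed p q dX dY C (⊕r s) = dY C s

¬Bad-& : ∀ {X Y} → NotTop X → NotTop Y → ¬ Bad (X & Y)
¬Bad-& () q (b13 _)
¬Bad-& p () (b14 _)

&-distributed : ∀ {X Y} → NotTop X → NotTop Y → Distributed X → Distributed Y → Distributed (X & Y)
&-distributed p q dX dY _ here b = ¬Bad-& p q b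
&-distributed p q dX dY C (&l s) = dX C s
&-distributed p q dX dY C (&r s) = dY C s

¬Bad-⊗ : ∀ {X Y} → ⊗-Factor X → ⊗-Factor Y → ¬ Bad (X ⊗ Y)
¬Bad-⊗ p () (b1 _ _ _)
¬Bad-⊗ () q (b2 _ _ _)
¬Bad-⊗ p () (b3 _)
¬Bad-⊗ () q (b4 _)
¬Bad-⊗ p () (b7 _)
¬Bad-⊗ () q (b8 _)

⊗-distributed : ∀ {X Y} → ⊗-Factor X → ⊗-Factor Y → Distributed X → Distributed Y → Distributed (X ⊗ Y)
⊗-distributed p q dX dY _ here b = ¬Bad-⊗ p q b
⊗-distributed p q dX dY C (⊗l s) = dX C s
⊗-distributed p q dX dY C (⊗r s) = dY C s

¬Bad-⅋ : ∀ {X Y} → ⅋-Factor X → ⅋-Factor Y → ¬ Bad (X ⅋ Y)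
¬Bad-⅋ () q (b9 _ _ _)
¬Bad-⅋ p () (b10 _ _ _)
¬Bad-⅋ () q (b11 _)
¬Bad-⅋ p () (b12 _)
¬Bad-⅋ () q (b15 _)
¬Bad-⅋ p () (b16 _)

⅋-distributed : ∀ {X Y} → ⅋-Factor X → ⅋-Factor Y → Distributed X → Distributed Y → Distributed (X ⅋ Y)
⅋-distributed p q dX dY _ here b = ¬Bad-⅋ p q b
⅋-distributed p q dX dY C (⅋l s) = dX C s
⅋-distributed p q dX dY C (⅋r s) = dY C s

plus-nf-distributed : ∀ {X Y} → Distributed X → Distributed Y → Distributed (plus-nf X Y)
plus-nf-distributed {X} {Y} dX dY with viewN X | viewN Y
... | isnul | _ = dY
... | notnul _ | isnul = dX
... | notnul p | notnul q = ⊕-distributed p q dX dY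

with-nf-distributed : ∀ {X Y} → Distributed X → Distributed Y → Distributed (with-nf X Y)
with-nf-distributed {X} {Y} dX dY with viewT X | viewT Y
... | istop | _ = dY
... | nottop _ | istop = dX
... | nottop p | nottop q = &-distributed p q dX dY

tens-nfʳ-distributed : ∀ {X Y} → ⊗-Factor X → Distributed X → Distributed Y → Distributed (tens-nfʳ X Y)
tens-nfʳ-distributed {X} {Y} p dX dY with view⊗ Y
... | v⊕ A B = plus-nf-distributed (tens-nfʳ-distributed p dX (⊕-distributedˡ dY)) (tens-nfʳ-distributed p dX (⊕-distributedʳ dY))
... | v0 = nul-distributed
... | v1 = dX
... | vp q = ⊗-distributed p q dX dY

tens-nf-distributed : ∀ {X Y} → Distributed X → Distributed Y → Distributed (tens-nf X Y)
tens-nf-distributed {X} {Y} dX dY with view⊗ X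
... | v⊕ A B = plus-nf-distributed (tens-nf-distributed (⊕-distributedˡ dX) dY) (tens-nf-distributed (⊕-distributedʳ dX) dY)
... | v0 = nul-distributed
... | v1 = dY
... | vp p = tens-nfʳ-distributed p dX dY

par-nfʳ-distributed : ∀ {X Y} → ⅋-Factor X → Distributed X → Distributed Y → Distributed (par-nfʳ X Y)
par-nfʳ-distributed {X} {Y} p dX dY with view⅋ Y
... | w& A B = with-nf-distributed (par-nfʳ-distributed p dX (&-distributedˡ dY)) (par-nfʳ-distributed p dX (&-distributedʳ dY))
... | wt = top-distributed
... | wb = dX
... | wp q = ⅋-distributed p q dX dY

par-nf-distributed : ∀ {X Y} → Distributed X → Distributed Y → Distributed (par-nf X Y)
par-nf-distributed {X} {Y} dX dY with view⅋ X
... | w& A B = with-nf-distributed (par-nf-distributed (&-distributedˡ dX) dY) (par-nf-distributed (&-distributedʳ dX) dY)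
... | wt = top-distributed
... | wb = dY
... | wp p = par-nfʳ-distributed p dX dY

nf-distributed : ∀ A → Distributed (nf A)
nf-distributed (var n) = var-distributed n
nf-distributed (covar n) = covar-distributed n
nf-distributed (A ⊗ B) = tens-nf-distributed (nf-distributed A) (nf-distributed B)
nf-distributed (A ⅋ B) = par-nf-distributed (nf-distributed A) (nf-distributed B)
nf-distributed one = one-distributed
nf-distributed bot = bot-distributed
nf-distributed (A & B) = with-nf-distributed (nf-distributed A) (nf-distributed B)
nf-distributed (A ⊕ B) = plus-nf-distributed (nf-distributed A) (nf-distributed B)
nf-distributed top = top-distributed
nf-distributed nul = nul-distributed

proposition5p5 : (∀ Ad Bd → Distributed Ad → Distributed Bd → Ad ≅ Bd → Ad =AC Bd) →
                 ∀ A B → A ≅ B → A =E B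
proposition5p5 distributed-complete A B A≅B =
  trans' (sym' (=NF⇒=E (nf-correct A)))
         (trans' (=AC⇒=E nfA=ACnfB) (=NF⇒=E (nf-correct B)))
  where
  nfA≅nfB : nf A ≅ nf B
  nfA≅nfB = ≅-trans (=NF⇒≅ (nf-correct A)) (≅-trans A≅B (≅-sym (=NF⇒≅ (nf-correct B))))

  nfA=ACnfB : nf A =AC nf B
  nfA=ACnfB = distributed-complete (nf A) (nf B) (nf-distributed A) (nf-distributed B) nfA≅nfB
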